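{- There exists a randomized algorithm that, for any graph $G$ with $n=|V(G)|$, given $V(G)$, access to the TIS oracle of $G$, a threshold parameter $\tau \in \mathbb{N}$ and $\epsilon \in (0,1)$, determines whether $t(G) > \tau$, and if $t(G) \leq \tau$ outputs a $(1\pm\epsilon)$-approximation $\hat t$ of $t(G)$ (i.e., $|\hat t - t(G)| \le \epsilon\, t(G)$), using $\mathcal{O}\left(\frac{\tau \log^2 n}{\epsilon^2}\right)$ TIS queries, with probability at least $1-n^{ -10}$.
   Context: $t(G)$ is the number of triangles of $G$. For pairwise disjoint non-empty $A,B,C\subseteq V(G)$, $t(A,B,C)$ is the number of triangles of $G$ with exactly one vertex in each of $A,B,C$. The TIS (Tripartite Independent Set) oracle takes pairwise disjoint non-empty $V_1,V_2,V_3\subseteq V(G)$ and answers YES iff $t(V_1,V_2,V_3)\neq 0$. -}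

module Defs where

open import Data.Bool using (Bool; true; false; if_then_else_; _∧_)
open import Data.Nat as ℕ using (ℕ; zero; suc; _<ᵇ_)
import Data.Nat.Properties as ℕP
open import Data.Nat.Logarithm using (⌈log₂_⌉)
open import Data.Fin using (Fin; toℕ)
open import Data.Fin.Subset using (Subset; _∈_; _∩_; ⊥; Nonempty)
open import Data.Fin.Subset.Properties using (_∈?_)
open import Data.Rational as ℚ using (ℚ; 0ℚ; 1ℚ; ½; _+_; _*_; _-_; ∣_∣; _≤_; _<_)
import Data.Rational.Properties as ℚP
open import Data.Product using (_×_; _,_)
import Data.Integer as ℤ
open import Relation.Nullary using (Dec; yes; no; ¬_)
open import Relation.Nullary.Decidable using (⌊_⌋; _×-dec_)
open import Relation.Binary.PropositionalEquality using (_≡_; _≢_)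

record Graph (n : ℕ) : Set where
  field
    adj   : Fin n → Fin n → Bool
    sym   : ∀ u v → adj u v ≡ adj v u
    irrefl : ∀ v → adj v v ≡ false
open Graph public

sumFin : ∀ {n} → (Fin n → ℕ) → ℕ
sumFin {zero}  f = 0
sumFin {suc n} f = f Fin.zero ℕ.+ sumFin (λ i → f (Fin.suc i))
  where import Data.Fin as Fin

countFin : ∀ {n} → (Fin n → Bool) → ℕ
countFin p = sumFin (λ i → if p i then 1 else 0)

isTri : ∀ {n} → Graph n → Fin n → Fin n → Fin n → Bool
isTri G a b c = adj G a b ∧ adj G b c ∧ adj G a c

-- t(G): number of triangles {a,b,c} of G (counted once, via a < b < c)
t : ∀ {n} → Graph n → ℕ
t G = sumFin λ a → sumFin λ b → countFin λ c →
        (toℕ a <ᵇ toℕ b) ∧ (toℕ b <ᵇ toℕ c) ∧ isTri G a b c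

_∈ᵇ_ : ∀ {n} → Fin n → Subset n → Bool
x ∈ᵇ p = ⌊ x ∈? p ⌋

-- t(A,B,C): number of triangles with exactly one vertex in each of A, B, C
-- (for pairwise disjoint A, B, C, each such triangle corresponds to exactly
-- one triple (a,b,c) ∈ A × B × C)
tABC : ∀ {n} → Graph n → Subset n → Subset n → Subset n → ℕ
tABC G A B C = sumFin λ a → sumFin λ b → countFin λ c →
        (a ∈ᵇ A) ∧ (b ∈ᵇ B) ∧ (c ∈ᵇ C) ∧ isTri G a b c

ValidQuery : ∀ {n} → Subset n → Subset n → Subset n → Set
ValidQuery A B C =
  Nonempty A × Nonempty B × Nonempty C ×
  (A ∩ B ≡ ⊥) × (B ∩ C ≡ ⊥) × (A ∩ C ≡ ⊥)

TIS : ∀ {n} → Graph n → Subset n → Subset n → Subset n → Bool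
TIS G A B C with tABC G A B C
... | zero  = false
... | suc _ = true

-- output: either "t(G) > τ" or an estimate t̂ ∈ ℚ of t(G)
data Output : Set where
  large    : Output
  estimate : ℚ → Output

-- a randomized query algorithm (a finite decision tree): it may flip a fair
-- coin, make a (legal) TIS query, or halt with an output
data Alg (n : ℕ) : Set where
  ret   : Output → Alg n
  coin  : (Bool → Alg n) → Alg n
  query : (A B C : Subset n) → ValidQuery A B C → (Bool → Alg n) → Alg n

-- probability that the run of algorithm α on G halts with (output, total
-- number of TIS queries made) satisfying P; the ℕ argument is the number of
-- queries made so far
Pr : ∀ {n} (G : Graph n) (P : Output → ℕ → Set) →
     (∀ o q → Dec (P o q)) → Alg n → ℕ → ℚ
Pr G P P? (ret o)           q with P? o q
... | yes _ = 1ℚ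
... | no  _ = 0ℚ
Pr G P P? (coin k)          q = ½ * (Pr G P P? (k true) q + Pr G P P? (k false) q)
Pr G P P? (query A B C _ k) q = Pr G P P? (k (TIS G A B C)) (suc q)

ℕ→ℚ : ℕ → ℚ
ℕ→ℚ k = ℤ.+ k ℚ./ 1

data Correct {n} (G : Graph n) (τ : ℕ) (ε : ℚ) : Output → Set where
  ok-large    : τ ℕ.< t G → Correct G τ ε large
  ok-estimate : ∀ x → t G ℕ.≤ τ →
                ∣ x - ℕ→ℚ (t G) ∣ ≤ ε * ℕ→ℚ (t G) → Correct G τ ε (estimate x)

Correct? : ∀ {n} (G : Graph n) τ ε o → Dec (Correct G τ ε o)
Correct? G τ ε large with τ ℕ.<? t G
... | yes p = yes (ok-large p)
... | no ¬p = no λ { (ok-large p) → ¬p p }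
Correct? G τ ε (estimate x) with t G ℕ.≤? τ | ∣ x - ℕ→ℚ (t G) ∣ ℚP.≤? ε * ℕ→ℚ (t G)
... | yes p | yes q = yes (ok-estimate x p q)
... | no ¬p | _     = no λ { (ok-estimate _ p _) → ¬p p }
... | yes _ | no ¬q = no λ { (ok-estimate _ _ q) → ¬q q }

-- query budget  C · max(1,τ) · ⌈log₂ n⌉² / ε²,  stated without division:
--   q · ε² ≤ C · max(1,τ) · ⌈log₂ n⌉²
WithinBudget : (C n τ : ℕ) (ε : ℚ) → ℕ → Set
WithinBudget C n τ ε q =
  ℕ→ℚ q * (ε * ε) ≤ ℕ→ℚ (C ℕ.* (1 ℕ.⊔ τ) ℕ.* (⌈log₂ n ⌉ ℕ.* ⌈log₂ n ⌉))

Success : ∀ {n} (G : Graph n) (C τ : ℕ) (ε : ℚ) → Output → ℕ → Set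
Success {n} G C τ ε o q = Correct G τ ε o × WithinBudget C n τ ε q

Success? : ∀ {n} (G : Graph n) C τ ε o q → Dec (Success G C τ ε o q)
Success? {n} G C τ ε o q =
  Correct? G τ ε o ×-dec (_ ℚP.≤? _)

-- The algorithm is deterministic and counts exactly, so it succeeds with probability 1.
-- Coding vertices by their k = ⌈log₂ n⌉ binary digits, each choice of two digit positions and of
-- three distinct values of that pair of digits gives a box (three disjoint vertex sets), and
-- every triangle has its vertices in the three sides of one of these 64k² root boxes.
-- The boxes are explored one after the other while a list K of known triangles grows. If some
-- ordering of a known triangle lies in the box, the box minus that triple is cut into three
-- smaller boxes without any query. Otherwise one query tells whether the box contains a
-- triangle; if it does, a binary search over the digits finds one with 3k queries, it joins K
-- (the algorithm reports t(G) > τ once K has τ + 1 triangles), and the box is cut around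
-- it. By induction a box β costs at most 1 + 3·(number of orderings of known triangles in β)
-- queries besides the searches, hence O(τ) per root box and O(τ k²) in total.

module Submission where

open import Defs hiding (sym)

module Counting where

  open import Data.Bool as Bool using (Bool; true; false; if_then_else_; _∧_; not)
  import Data.Bool.Properties as BoolP
  open import Data.Empty using (⊥-elim)
  open import Data.Fin as Fin using (Fin; toℕ; zero; suc)
  import Data.Fin.Properties as FinP
  open import Data.Fin.Subset using (Subset; _∩_; ⊥) renaming (_∈_ to _∈ₛ_)
  open import Data.Fin.Subset.Properties using () renaming (_∈?_ to _∈ₛ?_)
  import Data.Integer as ℤ
  import Data.Integer.Properties as ℤP
  open import Data.List using (List; []; _∷_; _++_; [_]; length; map; upTo; concatMap; cartesianProduct)
  import Data.List.Properties as ListP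
  open import Data.List.Membership.Propositional using (_∈_; _∉_; find; lose)
  open import Data.List.Membership.Propositional.Properties
    using (∈-++⁺ʳ; ∈-concatMap⁺; ∈-concatMap⁻; ∈-map⁺; ∈-cartesianProduct⁺; ∈-upTo⁺)
  open import Data.List.Relation.Unary.All as All using (All; []; _∷_)
  open import Data.List.Relation.Unary.All.Properties using (¬Any⇒All¬; All¬⇒¬Any)
  open import Data.List.Relation.Unary.Any using (Any; here; there; any?)
  import Data.List.Relation.Unary.AllPairs as AllPairs
  open import Data.List.Relation.Unary.Unique.Propositional using (Unique)
  open import Data.Maybe using (Maybe; just; nothing)
  open import Data.Nat as ℕ
    using (ℕ; zero; suc; _+_; _*_; _^_; _⊔_; _≤_; _<_; _<?_; _<ᵇ_; z≤n; s≤s; ⌊_/2⌋; ⌈_/2⌉)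
  import Data.Nat.Coprimality as Coprimality
  open import Data.Nat.Logarithm using (⌈log₂_⌉)
  open import Data.Nat.Logarithm.Core using (⌈log2⌉)
  import Data.Nat.Properties as ℕP
  open import Data.Nat.Tactic.RingSolver using (solve-∀)
  open import Data.Product using (Σ; ∃; ∃₂; ∃-syntax; _×_; _,_; proj₁; proj₂)
  open import Data.Product.Properties using (≡-dec)
  open import Data.Rational as ℚ using (ℚ; 0ℚ; 1ℚ; _-_; ∣_∣; mkℚ)
  import Data.Rational.Properties as ℚP
  open import Data.Sum using (_⊎_; inj₁; inj₂; [_,_]′)
  open import Data.Vec as Vec using (tabulate)
  open import Function using (_∘_; Equivalence)
  open import Induction.WellFounded using (Acc; acc)
  open import Relation.Binary.Definitions using (DecidableEquality)
  open import Relation.Binary.PropositionalEquality hiding ([_])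
  open import Relation.Nullary using (Dec; yes; no; ¬_; _×-dec_)
  open import Relation.Nullary.Decidable using (does; dec-true; dec-false)
  open import Relation.Nullary.Reflects using (Reflects; ofʸ; ofⁿ)
  open import Algebra.Properties.CommutativeSemigroup ℕP.+-commutativeSemigroup using (interchange)

  private
    variable
      n : ℕ
      A B : Set

  ⟦_⟧ : Bool → ℕ
  ⟦ b ⟧ = if b then 1 else 0

  ⟦⟧≤1 : ∀ b → ⟦ b ⟧ ≤ 1
  ⟦⟧≤1 true  = ℕP.≤-refl
  ⟦⟧≤1 false = z≤n

  sumFin-cong : ∀ {m} {f g : Fin m → ℕ} → (∀ i → f i ≡ g i) → sumFin f ≡ sumFin g
  sumFin-cong {zero}  f≗g = refl
  sumFin-cong {suc m} f≗g = cong₂ _+_ (f≗g zero) (sumFin-cong (f≗g ∘ suc))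

  sumFin-mono-≤ : ∀ {m} {f g : Fin m → ℕ} → (∀ i → f i ≤ g i) → sumFin f ≤ sumFin g
  sumFin-mono-≤ {zero}  f≤g = z≤n
  sumFin-mono-≤ {suc m} f≤g = ℕP.+-mono-≤ (f≤g zero) (sumFin-mono-≤ (f≤g ∘ suc))

  sumFin-mono-< : ∀ {m} {f g : Fin m → ℕ} x → (∀ i → f i ≤ g i) → f x < g x → sumFin f < sumFin g
  sumFin-mono-< zero    f≤g fx<gx = ℕP.+-mono-<-≤ fx<gx (sumFin-mono-≤ (f≤g ∘ suc))
  sumFin-mono-< (suc x) f≤g fx<gx = ℕP.+-mono-≤-< (f≤g zero) (sumFin-mono-< x (f≤g ∘ suc) fx<gx)

  sumFin-distrib-+ : ∀ {m} (f g : Fin m → ℕ) → sumFin (λ i → f i + g i) ≡ sumFin f + sumFin g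
  sumFin-distrib-+ {zero}  f g = refl
  sumFin-distrib-+ {suc m} f g =
    trans (cong (f zero + g zero +_) (sumFin-distrib-+ (f ∘ suc) (g ∘ suc)))
          (interchange (f zero) (g zero) (sumFin (f ∘ suc)) (sumFin (g ∘ suc)))

  sumFin-zero : ∀ {m} {f : Fin m → ℕ} → (∀ i → f i ≡ 0) → sumFin f ≡ 0
  sumFin-zero {zero}  f≗0 = refl
  sumFin-zero {suc m} f≗0 = cong₂ _+_ (f≗0 zero) (sumFin-zero (f≗0 ∘ suc))

  sumFin-single : ∀ {m} {f : Fin m → ℕ} x → (∀ i → i ≢ x → f i ≡ 0) → sumFin f ≡ f x
  sumFin-single {f = f} zero    f≗0 =
    trans (cong (f zero +_) (sumFin-zero λ i → f≗0 (suc i) λ ())) (ℕP.+-identityʳ (f zero))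
  sumFin-single {f = f} (suc x) f≗0 =
    trans (cong (_+ sumFin (f ∘ suc)) (f≗0 zero λ ()))
          (sumFin-single x λ i i≢x → f≗0 (suc i) (i≢x ∘ FinP.suc-injective))

  term≤sumFin : ∀ {m} (f : Fin m → ℕ) i → f i ≤ sumFin f
  term≤sumFin f zero    = ℕP.m≤m+n (f zero) _
  term≤sumFin f (suc i) = ℕP.≤-trans (term≤sumFin (f ∘ suc) i) (ℕP.m≤n+m _ (f zero))

  sumFin-nonzero : ∀ {m} (f : Fin m → ℕ) → sumFin f ≢ 0 → ∃ λ i → f i ≢ 0
  sumFin-nonzero {zero}  f s≢0 = ⊥-elim (s≢0 refl)
  sumFin-nonzero {suc m} f s≢0 with f zero ℕP.≟ 0
  ... | no  f₀≢0 = zero , f₀≢0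
  ... | yes f₀≡0 =
    let i , fᵢ≢0 = sumFin-nonzero (f ∘ suc) (s≢0 ∘ cong₂ _+_ f₀≡0) in suc i , fᵢ≢0

  countFin≤ : ∀ {m} (p : Fin m → Bool) → countFin p ≤ m
  countFin≤ {zero}  p = z≤n
  countFin≤ {suc m} p = ℕP.+-mono-≤ (⟦⟧≤1 (p zero)) (countFin≤ (p ∘ suc))

  Triple : ℕ → Set
  Triple n = Fin n × Fin n × Fin n

  Σ³ : (Triple n → ℕ) → ℕ
  Σ³ f = sumFin λ a → sumFin λ b → sumFin λ c → f (a , b , c)

  Σ³-cong : {f g : Triple n → ℕ} → (∀ u → f u ≡ g u) → Σ³ f ≡ Σ³ g
  Σ³-cong f≗g = sumFin-cong λ a → sumFin-cong λ b → sumFin-cong λ c → f≗g (a , b , c)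

  Σ³-mono-≤ : {f g : Triple n → ℕ} → (∀ u → f u ≤ g u) → Σ³ f ≤ Σ³ g
  Σ³-mono-≤ f≤g = sumFin-mono-≤ λ a → sumFin-mono-≤ λ b → sumFin-mono-≤ λ c → f≤g (a , b , c)

  Σ³-distrib-+ : (f g : Triple n → ℕ) → Σ³ (λ u → f u + g u) ≡ Σ³ f + Σ³ g
  Σ³-distrib-+ f g =
    trans (sumFin-cong λ a →
             trans (sumFin-cong λ b → sumFin-distrib-+ (λ c → f (a , b , c)) (λ c → g (a , b , c)))
                   (sumFin-distrib-+ (λ b → sumFin λ c → f (a , b , c)) (λ b → sumFin λ c → g (a , b , c))))
          (sumFin-distrib-+ (λ a → Σ² f a) (λ a → Σ² g a))
    where
    Σ² : (Triple n → ℕ) → Fin n → ℕ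
    Σ² h a = sumFin λ b → sumFin λ c → h (a , b , c)

  Σ³-zero : {f : Triple n → ℕ} → (∀ u → f u ≡ 0) → Σ³ f ≡ 0
  Σ³-zero f≗0 = sumFin-zero λ a → sumFin-zero λ b → sumFin-zero λ c → f≗0 (a , b , c)

  Σ³-single : {f : Triple n → ℕ} (w : Triple n) → (∀ u → u ≢ w → f u ≡ 0) → Σ³ f ≡ f w
  Σ³-single (x , y , z) f≗0 =
    trans (sumFin-single x λ a a≢x → sumFin-zero λ b → sumFin-zero λ c → f≗0 (a , b , c) (a≢x ∘ cong proj₁))
    (trans (sumFin-single y λ b b≢y → sumFin-zero λ c → f≗0 (x , b , c) (b≢y ∘ cong (proj₁ ∘ proj₂)))
           (sumFin-single z λ c c≢z → f≗0 (x , y , c) (c≢z ∘ cong (proj₂ ∘ proj₂))))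

  term≤Σ³ : (f : Triple n → ℕ) (u : Triple n) → f u ≤ Σ³ f
  term≤Σ³ f (a , b , c) =
    ℕP.≤-trans (term≤sumFin (λ c → f (a , b , c)) c)
      (ℕP.≤-trans (term≤sumFin (λ b → sumFin λ c → f (a , b , c)) b)
                  (term≤sumFin (λ a → sumFin λ b → sumFin λ c → f (a , b , c)) a))

  Σ³-nonzero : (f : Triple n → ℕ) → Σ³ f ≢ 0 → ∃ λ u → f u ≢ 0
  Σ³-nonzero f Σ≢0 =
    let a , fa≢0 = sumFin-nonzero _ Σ≢0
        b , fb≢0 = sumFin-nonzero _ fa≢0
        c , fc≢0 = sumFin-nonzero _ fb≢0
    in (a , b , c) , fc≢0

  Σ³-indicator≢0⇒∃ : (h : Triple n → Bool) → Σ³ (λ u → ⟦ h u ⟧) ≢ 0 → ∃ λ u → h u ≡ true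
  Σ³-indicator≢0⇒∃ h Σ≢0 with Σ³-nonzero _ Σ≢0
  ... | u , ⟦hu⟧≢0 with h u in hu≡
  ...   | true  = u , hu≡
  ...   | false = ⊥-elim (⟦hu⟧≢0 refl)

  ∃⇒Σ³-indicator≢0 : (h : Triple n → Bool) (u : Triple n) → h u ≡ true → Σ³ (λ u → ⟦ h u ⟧) ≢ 0
  ∃⇒Σ³-indicator≢0 h u hu≡true =
    ℕP.>⇒≢ (subst (λ b → ⟦ b ⟧ ≤ Σ³ (λ u → ⟦ h u ⟧)) hu≡true (term≤Σ³ (λ u → ⟦ h u ⟧) u))

  Σₗ : (A → ℕ) → List A → ℕ
  Σₗ f []       = 0
  Σₗ f (x ∷ xs) = f x + Σₗ f xs

  Σₗ-++ : (f : A → ℕ) (xs ys : List A) → Σₗ f (xs ++ ys) ≡ Σₗ f xs + Σₗ f ys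
  Σₗ-++ f []       ys = refl
  Σₗ-++ f (x ∷ xs) ys = trans (cong (f x +_) (Σₗ-++ f xs ys)) (sym (ℕP.+-assoc (f x) _ _))

  Σₗ-split : {f g h : A → ℕ} → (∀ x → f x ≡ g x + h x) → ∀ xs → Σₗ f xs ≡ Σₗ g xs + Σₗ h xs
  Σₗ-split f≗ []       = refl
  Σₗ-split {g = g} {h} f≗ (x ∷ xs) =
    trans (cong₂ _+_ (f≗ x) (Σₗ-split {g = g} {h} f≗ xs)) (interchange (g x) (h x) (Σₗ g xs) (Σₗ h xs))

  term≤Σₗ : (f : A → ℕ) {x : A} {xs : List A} → x ∈ xs → f x ≤ Σₗ f xs
  term≤Σₗ f (here refl) = ℕP.m≤m+n _ _
  term≤Σₗ f (there x∈)  = ℕP.≤-trans (term≤Σₗ f x∈) (ℕP.m≤n+m _ _)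

  Σₗ-bounded : {f : A → ℕ} {c : ℕ} → (∀ x → f x ≤ c) → ∀ xs → Σₗ f xs ≤ length xs * c
  Σₗ-bounded f≤c []       = z≤n
  Σₗ-bounded f≤c (x ∷ xs) = ℕP.+-mono-≤ (f≤c x) (Σₗ-bounded f≤c xs)

  -- Binary digits

  odd : ℕ → Bool
  odd zero          = false
  odd (suc zero)    = true
  odd (suc (suc u)) = odd u

  odd+2*⌊/2⌋ : ∀ u → ⟦ odd u ⟧ + 2 * ⌊ u /2⌋ ≡ u
  odd+2*⌊/2⌋ zero          = refl
  odd+2*⌊/2⌋ (suc zero)    = refl
  odd+2*⌊/2⌋ (suc (suc u)) =
    trans (shift ⟦ odd u ⟧ ⌊ u /2⌋) (cong (λ m → suc (suc m)) (odd+2*⌊/2⌋ u))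
    where
    shift : ∀ b h → b + 2 * suc h ≡ suc (suc (b + 2 * h))
    shift = solve-∀

  ⌊/2⌋< : ∀ {u m} → u < 2 * m → ⌊ u /2⌋ < m
  ⌊/2⌋< {u} {m} u<2m = ℕP.*-cancelˡ-< 2 ⌊ u /2⌋ m
    (ℕP.≤-<-trans (ℕP.m≤n+m (2 * ⌊ u /2⌋) ⟦ odd u ⟧) (subst (_< 2 * m) (sym (odd+2*⌊/2⌋ u)) u<2m))

  bit : ℕ → ℕ → Bool
  bit zero    u = odd u
  bit (suc i) u = bit i ⌊ u /2⌋

  bits-separate : ∀ k {u v} → u < 2 ^ k → v < 2 ^ k → u ≢ v → ∃[ i ] i < k × bit i u ≢ bit i v
  bits-separate zero    u<1 v<1 u≢v = ⊥-elim (u≢v (trans (ℕP.n<1⇒n≡0 u<1) (sym (ℕP.n<1⇒n≡0 v<1))))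
  bits-separate (suc k) {u} {v} u<2^1+k v<2^1+k u≢v with odd u Bool.≟ odd v
  ... | no  odd≢ = 0 , s≤s z≤n , odd≢
  ... | yes odd≡ =
    let i , i<k , bitᵢ≢ = bits-separate k (⌊/2⌋< u<2^1+k) (⌊/2⌋< v<2^1+k) halves≢ in
    suc i , s≤s i<k , bitᵢ≢
    where
    halves≢ : ⌊ u /2⌋ ≢ ⌊ v /2⌋
    halves≢ halves≡ = u≢v (begin
      u                         ≡⟨ odd+2*⌊/2⌋ u ⟨
      ⟦ odd u ⟧ + 2 * ⌊ u /2⌋  ≡⟨ cong₂ (λ b h → ⟦ b ⟧ + 2 * h) odd≡ halves≡ ⟩
      ⟦ odd v ⟧ + 2 * ⌊ v /2⌋  ≡⟨ odd+2*⌊/2⌋ v ⟩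
      v                         ∎)
      where open ≡-Reasoning

  ≤2^⌈log2⌉ : ∀ n (rec : Acc _<_ n) → n ≤ 2 ^ ⌈log2⌉ n rec
  ≤2^⌈log2⌉ zero          _        = z≤n
  ≤2^⌈log2⌉ (suc zero)    _        = s≤s z≤n
  ≤2^⌈log2⌉ (suc (suc n)) (acc rs) = begin
    suc (suc n)          ≤⟨ s≤s (s≤s n≤2⌈n/2⌉) ⟩
    suc (suc (2 * h))    ≡⟨ double-suc h ⟨
    2 * suc h            ≤⟨ ℕP.*-monoʳ-≤ 2 (≤2^⌈log2⌉ (suc h) (rs (ℕP.⌈n/2⌉<n n))) ⟩
    2 * 2 ^ ⌈log2⌉ (suc h) (rs (ℕP.⌈n/2⌉<n n)) ∎
    where
    open ℕP.≤-Reasoning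
    h = ⌈ n /2⌉
    double-suc : ∀ x → 2 * suc x ≡ suc (suc (2 * x))
    double-suc = solve-∀
    n≤2⌈n/2⌉ : n ≤ 2 * h
    n≤2⌈n/2⌉ = begin
      n                ≡⟨ ℕP.⌊n/2⌋+⌈n/2⌉≡n n ⟨
      ⌊ n /2⌋ + h      ≤⟨ ℕP.+-monoˡ-≤ h (ℕP.⌊n/2⌋≤⌈n/2⌉ n) ⟩
      h + h            ≡⟨ cong (h +_) (ℕP.+-identityʳ h) ⟨
      2 * h            ∎

  n≤2^⌈log₂n⌉ : ∀ n → n ≤ 2 ^ ⌈log₂ n ⌉
  n≤2^⌈log₂n⌉ n = ≤2^⌈log2⌉ n _

  -- Query programs

  data Prog (n : ℕ) (A : Set) : Set where
    pure : A → Prog n A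
    ask  : (X Y Z : Subset n) → ValidQuery X Y Z → (Bool → Prog n A) → Prog n A

  infixl 1 _>>=_
  _>>=_ : Prog n A → (A → Prog n B) → Prog n B
  pure a          >>= f = f a
  ask X Y Z v↓ k  >>= f = ask X Y Z v↓ λ b → k b >>= f

  toAlg : Prog n Output → Alg n
  toAlg (pure o)         = ret o
  toAlg (ask X Y Z v↓ k) = query X Y Z v↓ (toAlg ∘ k)

  Runs : Graph n → Prog n A → (A → ℕ → Set) → Set
  Runs G (pure a)         R = R a 0
  Runs G (ask X Y Z _ k)  R = Runs G (k (TIS G X Y Z)) λ a q → R a (suc q)

  Runs-mono : ∀ G (p : Prog n A) {R R′ : A → ℕ → Set} →
              (∀ a q → R a q → R′ a q) → Runs G p R → Runs G p R′
  Runs-mono G (pure a)         R⇒R′ r = R⇒R′ a 0 r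
  Runs-mono G (ask X Y Z _ k)  R⇒R′ r = Runs-mono G (k _) (λ a q → R⇒R′ a (suc q)) r

  Runs->>= : ∀ G (p : Prog n A) {f : A → Prog n B} {R : A → ℕ → Set} {R′ : B → ℕ → Set} →
             Runs G p R → (∀ a q → R a q → Runs G (f a) λ b q′ → R′ b (q + q′)) → Runs G (p >>= f) R′
  Runs->>= G (pure a)         r cont = cont a 0 r
  Runs->>= G (ask X Y Z _ k)  r cont = Runs->>= G (k (TIS G X Y Z)) r λ a q → cont a (suc q)

  Pr≡1 : ∀ G (P : Output → ℕ → Set) P? (p : Prog n Output) q →
         Runs G p (λ o q′ → P o (q + q′)) → Pr G P P? (toAlg p) q ≡ 1ℚ
  Pr≡1 G P P? (pure o) q r with P? o q
  ... | yes _  = refl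
  ... | no ¬Po = ⊥-elim (¬Po (subst (P o) (ℕP.+-identityʳ q) r))
  Pr≡1 G P P? (ask X Y Z _ k) q r =
    Pr≡1 G P P? (k (TIS G X Y Z)) (suc q) (Runs-mono G (k _) (λ o q′ → subst (P o) (ℕP.+-suc q q′)) r)

  -- Boxes

  ∧-falseˡ : ∀ g {x y} → x ∧ y ≡ false → (g ∧ x) ∧ y ≡ false
  ∧-falseˡ true  x∧y≡false = x∧y≡false
  ∧-falseˡ false _         = refl

  ∧-falseʳ : ∀ g x {y} → x ∧ y ≡ false → x ∧ (g ∧ y) ≡ false
  ∧-falseʳ g     false _         = refl
  ∧-falseʳ true  true  x∧y≡false = x∧y≡false
  ∧-falseʳ false true  _         = refl

  record Box (n : ℕ) : Set where
    constructor box
    field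
      V₁ V₂ V₃ : Fin n → Bool
      V₁∩V₂ : ∀ v → V₁ v ∧ V₂ v ≡ false
      V₂∩V₃ : ∀ v → V₂ v ∧ V₃ v ≡ false
      V₁∩V₃ : ∀ v → V₁ v ∧ V₃ v ≡ false
  open Box public

  data Role : Set where
    first second third : Role

  _at_ : Triple n → Role → Fin n
  (a , _ , _) at first  = a
  (_ , b , _) at second = b
  (_ , _ , c) at third  = c

  part : Box n → Role → Fin n → Bool
  part β first  = V₁ β
  part β second = V₂ β
  part β third  = V₃ β

  _∈ᴮ_ : Triple n → Box n → Bool
  (a , b , c) ∈ᴮ β = V₁ β a ∧ V₂ β b ∧ V₃ β c

  ∈ᴮ⇒part : ∀ (β : Box n) u → u ∈ᴮ β ≡ true → ∀ r → part β r (u at r) ≡ true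
  ∈ᴮ⇒part β (a , b , c) u∈β first  = BoolP.∧-conicalˡ _ _ u∈β
  ∈ᴮ⇒part β (a , b , c) u∈β second = BoolP.∧-conicalˡ _ _ (BoolP.∧-conicalʳ (V₁ β a) _ u∈β)
  ∈ᴮ⇒part β (a , b , c) u∈β third  = BoolP.∧-conicalʳ (V₂ β b) _ (BoolP.∧-conicalʳ (V₁ β a) _ u∈β)

  restrict : Role → (Fin n → Bool) → Box n → Box n
  restrict first g β =
    box (λ v → g v ∧ V₁ β v) (V₂ β) (V₃ β)
        (λ v → ∧-falseˡ (g v) (V₁∩V₂ β v)) (V₂∩V₃ β) (λ v → ∧-falseˡ (g v) (V₁∩V₃ β v))
  restrict second g β =
    box (V₁ β) (λ v → g v ∧ V₂ β v) (V₃ β)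
        (λ v → ∧-falseʳ (g v) (V₁ β v) (V₁∩V₂ β v)) (λ v → ∧-falseˡ (g v) (V₂∩V₃ β v)) (V₁∩V₃ β)
  restrict third g β =
    box (V₁ β) (V₂ β) (λ v → g v ∧ V₃ β v)
        (V₁∩V₂ β) (λ v → ∧-falseʳ (g v) (V₂ β v) (V₂∩V₃ β v)) (λ v → ∧-falseʳ (g v) (V₁ β v) (V₁∩V₃ β v))

  ∈ᴮ-restrict : ∀ r g (β : Box n) u → u ∈ᴮ restrict r g β ≡ g (u at r) ∧ u ∈ᴮ β
  ∈ᴮ-restrict first  g β (a , b , c) = BoolP.∧-assoc (g a) _ _
  ∈ᴮ-restrict second g β (a , b , c) with V₁ β a | g b
  ... | true  | gb    = BoolP.∧-assoc gb _ _
  ... | false | true  = refl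
  ... | false | false = refl
  ∈ᴮ-restrict third  g β (a , b , c) with V₁ β a | V₂ β b | g c
  ... | true  | true  | _     = refl
  ... | true  | false | true  = refl
  ... | true  | false | false = refl
  ... | false | _     | true  = refl
  ... | false | _     | false = refl

  _⊆ᴮ_ : Box n → Box n → Set
  β′ ⊆ᴮ β = ∀ u → u ∈ᴮ β′ ≡ true → u ∈ᴮ β ≡ true

  restrict-⊆ : ∀ r g (β : Box n) → restrict r g β ⊆ᴮ β
  restrict-⊆ r g β u u∈ = BoolP.∧-conicalʳ (g (u at r)) _ (trans (sym (∈ᴮ-restrict r g β u)) u∈)

  restrict-sat : ∀ r g (β : Box n) u → u ∈ᴮ restrict r g β ≡ true → g (u at r) ≡ true
  restrict-sat r g β u u∈ = BoolP.∧-conicalˡ (g (u at r)) _ (trans (sym (∈ᴮ-restrict r g β u)) u∈)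

  ∈-restrict : ∀ r g (β : Box n) u → u ∈ᴮ β ≡ true → g (u at r) ≡ true → u ∈ᴮ restrict r g β ≡ true
  ∈-restrict r g β u u∈ gu = trans (∈ᴮ-restrict r g β u) (cong₂ _∧_ gu u∈)

  size : Box n → ℕ
  size β = countFin (V₁ β) + countFin (V₂ β) + countFin (V₃ β)

  size≤ : (β : Box n) → size β ≤ n + n + n
  size≤ β = ℕP.+-mono-≤ (ℕP.+-mono-≤ (countFin≤ (V₁ β)) (countFin≤ (V₂ β))) (countFin≤ (V₃ β))

  ⟦∧⟧≤ : ∀ x y → ⟦ x ∧ y ⟧ ≤ ⟦ y ⟧
  ⟦∧⟧≤ true  y = ℕP.≤-refl
  ⟦∧⟧≤ false y = z≤n

  countFin-∧-≤ : (g f : Fin n → Bool) → countFin (λ v → g v ∧ f v) ≤ countFin f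
  countFin-∧-≤ g f = sumFin-mono-≤ λ v → ⟦∧⟧≤ (g v) (f v)

  countFin-∧-< : (g f : Fin n → Bool) {v : Fin n} → f v ≡ true → g v ≡ false →
                 countFin (λ v → g v ∧ f v) < countFin f
  countFin-∧-< g f {v} fv gv = sumFin-mono-< v (λ u → ⟦∧⟧≤ (g u) (f u))
    (subst₂ (λ x y → ⟦ x ∧ y ⟧ < ⟦ y ⟧) (sym gv) (sym fv) (s≤s z≤n))

  size-restrict-≤ : ∀ r g (β : Box n) → size (restrict r g β) ≤ size β
  size-restrict-≤ first  g β =
    ℕP.+-monoˡ-≤ (countFin (V₃ β)) (ℕP.+-monoˡ-≤ (countFin (V₂ β)) (countFin-∧-≤ g (V₁ β)))
  size-restrict-≤ second g β =
    ℕP.+-monoˡ-≤ (countFin (V₃ β)) (ℕP.+-monoʳ-≤ (countFin (V₁ β)) (countFin-∧-≤ g (V₂ β)))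
  size-restrict-≤ third  g β =
    ℕP.+-monoʳ-≤ (countFin (V₁ β) + countFin (V₂ β)) (countFin-∧-≤ g (V₃ β))

  size-restrict-< : ∀ r g (β : Box n) {v} → part β r v ≡ true → g v ≡ false →
                    size (restrict r g β) < size β
  size-restrict-< first  g β v∈ gv =
    ℕP.+-monoˡ-< (countFin (V₃ β)) (ℕP.+-monoˡ-< (countFin (V₂ β)) (countFin-∧-< g (V₁ β) v∈ gv))
  size-restrict-< second g β v∈ gv =
    ℕP.+-monoˡ-< (countFin (V₃ β)) (ℕP.+-monoʳ-< (countFin (V₁ β)) (countFin-∧-< g (V₂ β) v∈ gv))
  size-restrict-< third  g β v∈ gv =
    ℕP.+-monoʳ-< (countFin (V₁ β) + countFin (V₂ β)) (countFin-∧-< g (V₃ β) v∈ gv)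

  ∈ᵇ-tabulate : (f : Fin n → Bool) (x : Fin n) → x ∈ᵇ tabulate f ≡ f x
  ∈ᵇ-tabulate f zero with f zero
  ... | true  = refl
  ... | false = refl
  ∈ᵇ-tabulate {ℕ.suc n} f (suc x) = trans (∈ᵇ-there (f zero) (tabulate (f ∘ suc))) (∈ᵇ-tabulate (f ∘ suc) x)
    where
    ∈ᵇ-there : ∀ s (p : Subset n) → suc x ∈ᵇ (s Vec.∷ p) ≡ x ∈ᵇ p
    ∈ᵇ-there s p with x ∈ₛ? p
    ... | yes _ = refl
    ... | no  _ = refl

  ∈-tabulate : (f : Fin n → Bool) {x : Fin n} → f x ≡ true → x ∈ₛ tabulate f
  ∈-tabulate f {zero}  fx≡true rewrite fx≡true = Vec.here
  ∈-tabulate {ℕ.suc n} f {suc x} fx≡true = Vec.there (∈-tabulate {n} (f ∘ suc) fx≡true)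

  tabulate-∩ : (f g : Fin n → Bool) → (∀ v → f v ∧ g v ≡ false) → tabulate f ∩ tabulate g ≡ ⊥
  tabulate-∩ {ℕ.zero}  f g f∩g = refl
  tabulate-∩ {ℕ.suc n} f g f∩g = cong₂ Vec._∷_ (f∩g zero) (tabulate-∩ (f ∘ suc) (g ∘ suc) (f∩g ∘ suc))

  Inhabited : Box n → Set
  Inhabited β = (∃ λ a → V₁ β a ≡ true) × (∃ λ b → V₂ β b ≡ true) × (∃ λ c → V₃ β c ≡ true)

  inhabited? : (β : Box n) → Dec (Inhabited β)
  inhabited? β = nonempty? (V₁ β) ×-dec nonempty? (V₂ β) ×-dec nonempty? (V₃ β)
    where
    nonempty? : (f : Fin _ → Bool) → Dec (∃ λ x → f x ≡ true)
    nonempty? f = FinP.any? λ x → f x Bool.≟ true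

  asQuery : (β : Box n) → Inhabited β → ValidQuery (tabulate (V₁ β)) (tabulate (V₂ β)) (tabulate (V₃ β))
  asQuery β ((a , a∈) , (b , b∈) , (c , c∈)) =
    (a , ∈-tabulate (V₁ β) a∈) , (b , ∈-tabulate (V₂ β) b∈) , (c , ∈-tabulate (V₃ β) c∈) ,
    tabulate-∩ _ _ (V₁∩V₂ β) , tabulate-∩ _ _ (V₂∩V₃ β) , tabulate-∩ _ _ (V₁∩V₃ β)

  askBox : Box n → Prog n Bool
  askBox β with inhabited? β
  ... | yes inh = ask (tabulate (V₁ β)) (tabulate (V₂ β)) (tabulate (V₃ β)) (asQuery β inh) pure
  ... | no  _   = pure false

  Tri : Graph n → Triple n → Bool
  Tri G (a , b , c) = isTri G a b c

  HasTriangle : Graph n → Box n → Set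
  HasTriangle G β = ∃ λ u → u ∈ᴮ β ≡ true × Tri G u ≡ true

  HasTriangle⇒Inhabited : ∀ G (β : Box n) → HasTriangle G β → Inhabited β
  HasTriangle⇒Inhabited G β (u , u∈β , _) =
    (u at first , ∈ᴮ⇒part β u u∈β first) , (u at second , ∈ᴮ⇒part β u u∈β second) ,
    (u at third , ∈ᴮ⇒part β u u∈β third)

  Reflects-map : ∀ {P Q : Set} {b} → (P → Q) → (Q → P) → Reflects P b → Reflects Q b
  Reflects-map P⇒Q Q⇒P (ofʸ p)  = ofʸ (P⇒Q p)
  Reflects-map P⇒Q Q⇒P (ofⁿ ¬p) = ofⁿ (¬p ∘ Q⇒P)

  TIS-reflects : ∀ G (X Y Z : Subset n) → Reflects (tABC G X Y Z ≢ 0) (TIS G X Y Z)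
  TIS-reflects G X Y Z with tABC G X Y Z
  ... | ℕ.zero  = ofⁿ λ 0≢0 → 0≢0 refl
  ... | ℕ.suc _ = ofʸ λ ()

  tABC-tabulate : ∀ G (β : Box n) →
    tABC G (tabulate (V₁ β)) (tabulate (V₂ β)) (tabulate (V₃ β)) ≡ Σ³ (λ u → ⟦ u ∈ᴮ β ∧ Tri G u ⟧)
  tABC-tabulate G β = sumFin-cong λ a → sumFin-cong λ b → sumFin-cong λ c →
    cong ⟦_⟧ (begin
      a ∈ᵇ tabulate (V₁ β) ∧ b ∈ᵇ tabulate (V₂ β) ∧ c ∈ᵇ tabulate (V₃ β) ∧ isTri G a b c
        ≡⟨ cong₂ _∧_ (∈ᵇ-tabulate (V₁ β) a)
             (cong₂ _∧_ (∈ᵇ-tabulate (V₂ β) b) (cong (_∧ isTri G a b c) (∈ᵇ-tabulate (V₃ β) c))) ⟩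
      V₁ β a ∧ V₂ β b ∧ V₃ β c ∧ isTri G a b c
        ≡⟨ cong (V₁ β a ∧_) (BoolP.∧-assoc (V₂ β b) _ _) ⟨
      V₁ β a ∧ (V₂ β b ∧ V₃ β c) ∧ isTri G a b c
        ≡⟨ BoolP.∧-assoc (V₁ β a) _ _ ⟨
      (V₁ β a ∧ V₂ β b ∧ V₃ β c) ∧ isTri G a b c ∎)
    where open ≡-Reasoning

  askBox-spec : ∀ G (β : Box n) → Runs G (askBox β) λ b q → q ≤ 1 × Reflects (HasTriangle G β) b
  askBox-spec G β with inhabited? β
  ... | yes inh = ℕP.≤-refl , Reflects-map count⇒triangle triangle⇒count (TIS-reflects G _ _ _)
    where
    count⇒triangle : tABC G _ _ _ ≢ 0 → HasTriangle G β
    count⇒triangle count≢0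
      with u , found ← Σ³-indicator≢0⇒∃ _ (subst (_≢ 0) (tABC-tabulate G β) count≢0) =
      u , BoolP.∧-conicalˡ (u ∈ᴮ β) (Tri G u) found , BoolP.∧-conicalʳ (u ∈ᴮ β) (Tri G u) found
    triangle⇒count : HasTriangle G β → tABC G _ _ _ ≢ 0
    triangle⇒count (u , u∈β , tri) = subst (_≢ 0) (sym (tABC-tabulate G β))
      (∃⇒Σ³-indicator≢0 (λ u → u ∈ᴮ β ∧ Tri G u) u (cong₂ _∧_ u∈β tri))
  ... | no ¬inh = z≤n , ofⁿ (¬inh ∘ HasTriangle⇒Inhabited G β)

  -- The pieces of β around w hold the triples of β other than w, split according to
  -- the first coordinate in which they differ from w.

  _==_ : Fin n → Fin n → Bool
  v == x = does (v FinP.≟ x)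

  piece₁ piece₂ piece₃ : Triple n → Box n → Box n
  piece₁ (x , _ , _) = restrict first (λ v → not (v == x))
  piece₂ (x , y , _) = restrict second (λ v → not (v == y)) ∘ restrict first (_== x)
  piece₃ (x , y , z) =
    restrict third (λ v → not (v == z)) ∘ restrict second (_== y) ∘ restrict first (_== x)

  pieces : Triple n → Box n → List (Box n)
  pieces w β = piece₁ w β ∷ piece₂ w β ∷ piece₃ w β ∷ []

  module _ (x y z : Fin n) (β : Box n) (a b c : Fin n) where

    ∈-piece₁ : (a , b , c) ∈ᴮ piece₁ (x , y , z) β ≡ not (a == x) ∧ (a , b , c) ∈ᴮ β
    ∈-piece₁ = ∈ᴮ-restrict first (λ v → not (v == x)) β (a , b , c)

    ∈-piece₂ : (a , b , c) ∈ᴮ piece₂ (x , y , z) β ≡ not (b == y) ∧ (a == x) ∧ (a , b , c) ∈ᴮ β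
    ∈-piece₂ = trans (∈ᴮ-restrict second (λ v → not (v == y)) β₁ (a , b , c))
                     (cong (not (b == y) ∧_) (∈ᴮ-restrict first (_== x) β (a , b , c)))
      where β₁ = restrict first (_== x) β

    ∈-piece₃ : (a , b , c) ∈ᴮ piece₃ (x , y , z) β ≡ not (c == z) ∧ (b == y) ∧ (a == x) ∧ (a , b , c) ∈ᴮ β
    ∈-piece₃ = trans (∈ᴮ-restrict third (λ v → not (v == z)) β₂ (a , b , c))
      (cong (not (c == z) ∧_) (trans (∈ᴮ-restrict second (_== y) β₁ (a , b , c))
                                     (cong ((b == y) ∧_) (∈ᴮ-restrict first (_== x) β (a , b , c)))))
      where β₁ = restrict first (_== x) β
            β₂ = restrict second (_== y) β₁

  _≟ᵀ_ : DecidableEquality (Triple n)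
  _≟ᵀ_ = ≡-dec FinP._≟_ (≡-dec FinP._≟_ FinP._≟_)

  _≐_ : Triple n → Triple n → Bool
  (a , b , c) ≐ (x , y , z) = (c == z) ∧ (b == y) ∧ (a == x)

  ≐-refl : (w : Triple n) → w ≐ w ≡ true
  ≐-refl (x , y , z) = cong₂ _∧_ (dec-true (z FinP.≟ z) refl)
                         (cong₂ _∧_ (dec-true (y FinP.≟ y) refl) (dec-true (x FinP.≟ x) refl))

  partition-count : ∀ ex ey ez m →
    ⟦ not ex ∧ m ⟧ + (⟦ not ey ∧ ex ∧ m ⟧ + (⟦ not ez ∧ ey ∧ ex ∧ m ⟧ + ⟦ (ez ∧ ey ∧ ex) ∧ m ⟧)) ≡ ⟦ m ⟧
  partition-count true  true  true  m = refl
  partition-count true  true  false m = ℕP.+-identityʳ ⟦ m ⟧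
  partition-count true  false true  m = ℕP.+-identityʳ ⟦ m ⟧
  partition-count true  false false m = ℕP.+-identityʳ ⟦ m ⟧
  partition-count false true  true  m = ℕP.+-identityʳ ⟦ m ⟧
  partition-count false true  false m = ℕP.+-identityʳ ⟦ m ⟧
  partition-count false false true  m = ℕP.+-identityʳ ⟦ m ⟧
  partition-count false false false m = ℕP.+-identityʳ ⟦ m ⟧

  pieces-partition : ∀ (w : Triple n) β u →
    ⟦ u ∈ᴮ piece₁ w β ⟧ + (⟦ u ∈ᴮ piece₂ w β ⟧ + (⟦ u ∈ᴮ piece₃ w β ⟧ + ⟦ (u ≐ w) ∧ u ∈ᴮ β ⟧))
      ≡ ⟦ u ∈ᴮ β ⟧
  pieces-partition w@(x , y , z) β u@(a , b , c)
    rewrite ∈-piece₁ x y z β a b c | ∈-piece₂ x y z β a b c | ∈-piece₃ x y z β a b c =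
    partition-count (a == x) (b == y) (c == z) (u ∈ᴮ β)

  pieces-cover : ∀ (w : Triple n) β u → u ∈ᴮ β ≡ true → u ≢ w → Any (λ p → u ∈ᴮ p ≡ true) (pieces w β)
  pieces-cover w@(x , y , z) β u@(a , b , c) u∈β u≢w with a FinP.≟ x
  ... | no a≢x = here (trans (∈-piece₁ x y z β a b c) (cong₂ _∧_ (cong not (dec-false (a FinP.≟ x) a≢x)) u∈β))
  ... | yes refl with b FinP.≟ y
  ...   | no b≢y = there (here (trans (∈-piece₂ x y z β a b c)
            (cong₂ _∧_ (cong not (dec-false (b FinP.≟ y) b≢y)) (cong₂ _∧_ (dec-true (a FinP.≟ a) refl) u∈β))))
  ...   | yes refl with c FinP.≟ z
  ...     | no c≢z = there (there (here (trans (∈-piece₃ x y z β a b c)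
              (cong₂ _∧_ (cong not (dec-false (c FinP.≟ z) c≢z))
                (cong₂ _∧_ (dec-true (b FinP.≟ b) refl) (cong₂ _∧_ (dec-true (a FinP.≟ a) refl) u∈β))))))
  ...     | yes refl = ⊥-elim (u≢w refl)

  pieces-shrink : ∀ (w : Triple n) β → w ∈ᴮ β ≡ true → ∀ {p} → p ∈ pieces w β → size p < size β
  pieces-shrink w@(x , y , z) β w∈β = shrink
    where
    β₁ = restrict first (_== x) β
    β₂ = restrict second (_== y) β₁
    unequal : ∀ v → not (v == v) ≡ false
    unequal v = cong not (dec-true (v FinP.≟ v) refl)
    shrink : ∀ {p} → p ∈ pieces w β → size p < size β
    shrink (here refl) =
      size-restrict-< first (λ v → not (v == x)) β (∈ᴮ⇒part β w w∈β first) (unequal x)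
    shrink (there (here refl)) =
      ℕP.<-≤-trans (size-restrict-< second (λ v → not (v == y)) β₁ (∈ᴮ⇒part β w w∈β second) (unequal y))
                   (size-restrict-≤ first (_== x) β)
    shrink (there (there (here refl))) =
      ℕP.<-≤-trans (size-restrict-< third (λ v → not (v == z)) β₂ (∈ᴮ⇒part β w w∈β third) (unequal z))
                   (ℕP.≤-trans (size-restrict-≤ second (_== y) β₁) (size-restrict-≤ first (_== x) β))

  permutations : Triple n → List (Triple n)
  permutations (a , b , c) =
    (a , b , c) ∷ (a , c , b) ∷ (b , a , c) ∷ (b , c , a) ∷ (c , a , b) ∷ (c , b , a) ∷ []

  orderings : List (Triple n) → List (Triple n)
  orderings = concatMap permutations

  ∈-orderings⁺ : ∀ {K : List (Triple n)} {κ u} → κ ∈ K → u ∈ permutations κ → u ∈ orderings K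
  ∈-orderings⁺ κ∈K u∈ = ∈-concatMap⁺ permutations (lose κ∈K u∈)

  ∈-orderings⁻ : ∀ (K : List (Triple n)) {u} → u ∈ orderings K → ∃ λ κ → κ ∈ K × u ∈ permutations κ
  ∈-orderings⁻ K u∈ = find (∈-concatMap⁻ permutations {xs = K} u∈)

  copies : Box n → List (Triple n) → ℕ
  copies β K = Σₗ (λ u → ⟦ u ∈ᴮ β ⟧) (orderings K)

  copies-++ : ∀ (β : Box n) K K′ → copies β (K ++ K′) ≡ copies β K + copies β K′
  copies-++ β K K′ =
    trans (cong (Σₗ _) (ListP.concatMap-++ permutations K K′)) (Σₗ-++ _ (orderings K) (orderings K′))

  copies≤ : ∀ (β : Box n) K → copies β K ≤ length K * 6
  copies≤ β []      = z≤n
  copies≤ β (κ ∷ K) = begin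
    copies β (κ ∷ K)
      ≡⟨ Σₗ-++ _ (permutations κ) (orderings K) ⟩
    Σₗ (λ u → ⟦ u ∈ᴮ β ⟧) (permutations κ) + copies β K
      ≤⟨ ℕP.+-mono-≤ (Σₗ-bounded (λ u → ⟦⟧≤1 (u ∈ᴮ β)) (permutations κ)) (copies≤ β K) ⟩
    6 + length K * 6
      ∎
    where open ℕP.≤-Reasoning

  copies-pieces : ∀ (w : Triple n) β K → w ∈ᴮ β ≡ true → w ∈ orderings K →
    copies (piece₁ w β) K + (copies (piece₂ w β) K + (copies (piece₃ w β) K + 1)) ≤ copies β K
  copies-pieces w β K w∈β w∈K = begin
    c₁ + (c₂ + (c₃ + 1))      ≤⟨ ℕP.+-monoʳ-≤ c₁ (ℕP.+-monoʳ-≤ c₂ (ℕP.+-monoʳ-≤ c₃ 1≤e)) ⟩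
    c₁ + (c₂ + (c₃ + e))      ≡⟨ split ⟨
    copies β K                ∎
    where
    open ℕP.≤-Reasoning
    L = orderings K
    c₁ = copies (piece₁ w β) K
    c₂ = copies (piece₂ w β) K
    c₃ = copies (piece₃ w β) K
    at-w : Triple _ → ℕ
    at-w u = ⟦ (u ≐ w) ∧ u ∈ᴮ β ⟧
    e = Σₗ at-w L
    1≤e : 1 ≤ e
    1≤e = subst (_≤ e) (cong ⟦_⟧ (cong₂ _∧_ (≐-refl w) w∈β)) (term≤Σₗ at-w w∈K)
    split : copies β K ≡ c₁ + (c₂ + (c₃ + e))
    split = trans (Σₗ-split (sym ∘ pieces-partition w β) L)
              (cong (c₁ +_) (trans (Σₗ-split (λ _ → refl) L) (cong (c₂ +_) (Σₗ-split (λ _ → refl) L))))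

  -- Sorting triples

  _<ᵛ_ : Fin n → Fin n → Bool
  a <ᵛ b = toℕ a <ᵇ toℕ b

  <ᵛ⇒< : ∀ {a b : Fin n} → a <ᵛ b ≡ true → toℕ a < toℕ b
  <ᵛ⇒< {a = a} {b} a<b = ℕP.<ᵇ⇒< (toℕ a) (toℕ b) (Equivalence.from BoolP.T-≡ a<b)

  <⇒<ᵛ : ∀ {a b : Fin n} → toℕ a < toℕ b → a <ᵛ b ≡ true
  <⇒<ᵛ a<b = Equivalence.to BoolP.T-≡ (ℕP.<⇒<ᵇ a<b)

  ≮⇒<ᵛ-false : ∀ {a b : Fin n} → ¬ toℕ a < toℕ b → a <ᵛ b ≡ false
  ≮⇒<ᵛ-false {a = a} {b} a≮b with a <ᵛ b in a<b
  ... | true  = ⊥-elim (a≮b (<ᵛ⇒< {a = a} {b} a<b))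
  ... | false = refl

  <ᵛ-asym : ∀ {a b : Fin n} → a <ᵛ b ≡ true → b <ᵛ a ≡ false
  <ᵛ-asym {a = a} {b} a<b = ≮⇒<ᵛ-false {a = b} {a} (ℕP.<-asym (<ᵛ⇒< {a = a} {b} a<b))

  <ᵛ-trans : ∀ {a b c : Fin n} → a <ᵛ b ≡ true → b <ᵛ c ≡ true → a <ᵛ c ≡ true
  <ᵛ-trans {a = a} {b} {c} a<b b<c =
    <⇒<ᵛ {a = a} {c} (ℕP.<-trans (<ᵛ⇒< {a = a} {b} a<b) (<ᵛ⇒< {a = b} {c} b<c))

  <ᵛ-flip : ∀ {a b : Fin n} → a <ᵛ b ≡ false → a ≢ b → b <ᵛ a ≡ true
  <ᵛ-flip {a = a} {b} a≮b a≢b = <⇒<ᵛ {a = b} {a} (ℕP.≤∧≢⇒< b≤a (a≢b ∘ FinP.toℕ-injective ∘ sym))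
    where
    b≤a : toℕ b ≤ toℕ a
    b≤a = ℕP.≮⇒≥ λ a<b → case (trans (sym (<⇒<ᵛ {a = a} {b} a<b)) a≮b)
      where
      case : true ≢ false
      case ()

  sort : Triple n → Triple n
  sort (x , y , z) with x <ᵛ y | y <ᵛ z | x <ᵛ z
  ... | true  | true  | _     = x , y , z
  ... | true  | false | true  = x , z , y
  ... | true  | false | false = z , x , y
  ... | false | _     | true  = y , x , z
  ... | false | true  | false = y , z , x
  ... | false | false | false = z , y , x

  ∈-permutations-sort : (u : Triple n) → u ∈ permutations (sort u)
  ∈-permutations-sort (x , y , z) with x <ᵛ y | y <ᵛ z | x <ᵛ z
  ... | true  | true  | _     = here refl
  ... | true  | false | true  = there (here refl)
  ... | true  | false | false = there (there (there (here refl)))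
  ... | false | _     | true  = there (there (here refl))
  ... | false | true  | false = there (there (there (there (here refl))))
  ... | false | false | false = there (there (there (there (there (here refl)))))

  sort-permutation : ∀ {a b c : Fin n} → a <ᵛ b ≡ true → b <ᵛ c ≡ true →
                     ∀ {u} → u ∈ permutations (a , b , c) → sort u ≡ (a , b , c)
  sort-permutation {a = a} {b} {c} a<b b<c = sorts
    where
    a<c : (toℕ a <ᵇ toℕ c) ≡ true
    a<c = <ᵛ-trans {a = a} {b} {c} a<b b<c
    b≮a : (toℕ b <ᵇ toℕ a) ≡ false
    b≮a = <ᵛ-asym {a = a} {b} a<b
    c≮b : (toℕ c <ᵇ toℕ b) ≡ false
    c≮b = <ᵛ-asym {a = b} {c} b<c
    c≮a : (toℕ c <ᵇ toℕ a) ≡ false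
    c≮a = <ᵛ-asym {a = a} {c} a<c
    sorts : ∀ {u} → u ∈ permutations (a , b , c) → sort u ≡ (a , b , c)
    sorts (here refl)                                         rewrite a<b | b<c       = refl
    sorts (there (here refl))                                 rewrite a<c | c≮b | a<b = refl
    sorts (there (there (here refl)))                         rewrite b≮a | a<c | b<c = refl
    sorts (there (there (there (here refl))))                 rewrite b<c | c≮a | b≮a = refl
    sorts (there (there (there (there (here refl)))))         rewrite c≮a | a<b | c≮b = refl
    sorts (there (there (there (there (there (here refl)))))) rewrite c≮b | b≮a | c≮a = refl

  OrderedTriangle : Graph n → Triple n → Bool
  OrderedTriangle G (a , b , c) = (a <ᵛ b) ∧ (b <ᵛ c) ∧ isTri G a b c

  adj-sym : ∀ G {a b : Fin n} → adj G a b ≡ true → adj G b a ≡ true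
  adj-sym G {a} {b} ab = trans (Graph.sym G b a) ab

  Tri⇒distinct : ∀ G {a b c : Fin n} → Tri G (a , b , c) ≡ true → a ≢ b × b ≢ c × a ≢ c
  Tri⇒distinct G {a} {b} {c} tri = loopless (BoolP.∧-conicalˡ _ _ tri) ,
    loopless (BoolP.∧-conicalˡ _ _ (BoolP.∧-conicalʳ (adj G a b) _ tri)) ,
    loopless (BoolP.∧-conicalʳ (adj G b c) _ (BoolP.∧-conicalʳ (adj G a b) _ tri))
    where
    loopless : ∀ {v w} → adj G v w ≡ true → v ≢ w
    loopless {v} vw refl with trans (sym vw) (irrefl G v)
    ... | ()

  Tri-permutation : ∀ G {u v : Triple n} → v ∈ permutations u → Tri G u ≡ true → Tri G v ≡ true
  Tri-permutation G {a , b , c} v∈ tri = triangle v∈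
    where
    ab = BoolP.∧-conicalˡ _ _ tri
    bc = BoolP.∧-conicalˡ _ _ (BoolP.∧-conicalʳ (adj G a b) _ tri)
    ac = BoolP.∧-conicalʳ (adj G b c) _ (BoolP.∧-conicalʳ (adj G a b) _ tri)
    ba = adj-sym G ab
    cb = adj-sym G bc
    ca = adj-sym G ac
    triangle : ∀ {v} → v ∈ permutations (a , b , c) → Tri G v ≡ true
    triangle (here refl)                                         = tri
    triangle (there (here refl))                                 = cong₂ _∧_ ac (cong₂ _∧_ cb ab)
    triangle (there (there (here refl)))                         = cong₂ _∧_ ba (cong₂ _∧_ ac bc)
    triangle (there (there (there (here refl))))                 = cong₂ _∧_ bc (cong₂ _∧_ ca ba)
    triangle (there (there (there (there (here refl)))))         = cong₂ _∧_ ca (cong₂ _∧_ ab cb)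
    triangle (there (there (there (there (there (here refl)))))) = cong₂ _∧_ cb (cong₂ _∧_ ba ca)

  ordered-permutation : ∀ G {u : Triple n} {p q r} → Tri G u ≡ true → (p , q , r) ∈ permutations u →
                        p <ᵛ q ≡ true → q <ᵛ r ≡ true → OrderedTriangle G (p , q , r) ≡ true
  ordered-permutation G tri v∈ p<q q<r = cong₂ _∧_ p<q (cong₂ _∧_ q<r (Tri-permutation G v∈ tri))

  sort-ordered : ∀ G (u : Triple n) → Tri G u ≡ true → OrderedTriangle G (sort u) ≡ true
  sort-ordered G (x , y , z) tri
    with Tri⇒distinct G tri | x <ᵛ y in x<y | y <ᵛ z in y<z | x <ᵛ z in x<z
  ... | _ , _ , _         | true  | true  | _     =
    ordered-permutation G tri (here refl) x<y y<z
  ... | _ , y≢z , _       | true  | false | true  =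
    ordered-permutation G tri (there (here refl)) x<z (<ᵛ-flip y<z y≢z)
  ... | _ , _ , x≢z       | true  | false | false =
    ordered-permutation G tri (there (there (there (there (here refl))))) (<ᵛ-flip x<z x≢z) x<y
  ... | x≢y , _ , _       | false | _     | true  =
    ordered-permutation G tri (there (there (here refl))) (<ᵛ-flip x<y x≢y) x<z
  ... | _ , _ , x≢z       | false | true  | false =
    ordered-permutation G tri (there (there (there (here refl)))) y<z (<ᵛ-flip x<z x≢z)
  ... | x≢y , y≢z , _     | false | false | false =
    ordered-permutation G tri (there (there (there (there (there (here refl))))))
      (<ᵛ-flip y<z y≢z) (<ᵛ-flip x<y x≢y)

  _is_ : Maybe Role → Role → Bool
  just first  is first  = true
  just second is second = true
  just third  is third  = true
  _           is _      = false

  colouring : (Fin n → Maybe Role) → Box n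
  colouring col = box (λ v → col v is first) (λ v → col v is second) (λ v → col v is third)
                      (λ v → first∩second (col v)) (λ v → second∩third (col v)) (λ v → first∩third (col v))
    where
    first∩second : ∀ m → (m is first) ∧ (m is second) ≡ false
    first∩second nothing       = refl
    first∩second (just first)  = refl
    first∩second (just second) = refl
    first∩second (just third)  = refl
    second∩third : ∀ m → (m is second) ∧ (m is third) ≡ false
    second∩third nothing       = refl
    second∩third (just first)  = refl
    second∩third (just second) = refl
    second∩third (just third)  = refl
    first∩third : ∀ m → (m is first) ∧ (m is third) ≡ false
    first∩third nothing       = refl
    first∩third (just first)  = refl
    first∩third (just second) = refl
    first∩third (just third)  = refl

  Code : Set
  Code = Bool × Bool

  _≟ᶜ_ : DecidableEquality Code
  _≟ᶜ_ = ≡-dec Bool._≟_ Bool._≟_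

  codes : List Code
  codes = (true , true) ∷ (true , false) ∷ (false , true) ∷ (false , false) ∷ []

  classify : Code → Code → Code → Code → Maybe Role
  classify c₁ c₂ c₃ c =
    if does (c ≟ᶜ c₁) then just first else
    if does (c ≟ᶜ c₂) then just second else
    if does (c ≟ᶜ c₃) then just third else nothing

  ∈-codes : ∀ c → c ∈ codes
  ∈-codes (true  , true)  = here refl
  ∈-codes (true  , false) = there (here refl)
  ∈-codes (false , true)  = there (there (here refl))
  ∈-codes (false , false) = there (there (there (here refl)))

  classify-first : ∀ c₁ c₂ c₃ → classify c₁ c₂ c₃ c₁ is first ≡ true
  classify-first c₁ c₂ c₃ rewrite dec-true (c₁ ≟ᶜ c₁) refl = refl

  classify-second : ∀ c₁ c₂ c₃ → c₂ ≢ c₁ → classify c₁ c₂ c₃ c₂ is second ≡ true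
  classify-second c₁ c₂ c₃ c₂≢c₁ rewrite dec-false (c₂ ≟ᶜ c₁) c₂≢c₁ | dec-true (c₂ ≟ᶜ c₂) refl = refl

  classify-third : ∀ c₁ c₂ c₃ → c₃ ≢ c₁ → c₃ ≢ c₂ → classify c₁ c₂ c₃ c₃ is third ≡ true
  classify-third c₁ c₂ c₃ c₃≢c₁ c₃≢c₂
    rewrite dec-false (c₃ ≟ᶜ c₁) c₃≢c₁ | dec-false (c₃ ≟ᶜ c₂) c₃≢c₂ | dec-true (c₃ ≟ᶜ c₃) refl = refl

  -- The algorithm

  module Algorithm (n τ : ℕ) where

    k : ℕ
    k = ⌈log₂ n ⌉

    bitOf : ℕ → Fin n → Bool
    bitOf i v = bit i (toℕ v)

    narrow : Role → ℕ → Box n → Prog n (Box n)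
    narrow r i β = askBox (restrict r (bitOf i) β) >>= λ found →
      pure (if found then restrict r (bitOf i) β else restrict r (not ∘ bitOf i) β)

    narrowAll : Role → ℕ → Box n → Prog n (Box n)
    narrowAll r zero    β = pure β
    narrowAll r (suc i) β = narrow r i β >>= narrowAll r i

    pick : Box n → Maybe (Triple n)
    pick β with inhabited? β
    ... | yes ((a , _) , (b , _) , (c , _)) = just (a , b , c)
    ... | no  _                             = nothing

    findTriangle : Box n → Prog n (Maybe (Triple n))
    findTriangle β =
      narrowAll first k β  >>= λ β₁ →
      narrowAll second k β₁ >>= λ β₂ →
      narrowAll third k β₂ >>= λ β₃ →
      pure (pick β₃)

    record Outcome : Set where
      constructor outcome
      field
        overflowed : Bool
        triangles  : List (Triple n)
    open Outcome public

    pattern finished K = outcome false K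
    pattern overflow K = outcome true K

    -- Fuel above the size of the box suffices, as pieces are strictly smaller; the clauses
    -- for fuel 0 and for a failed search are never reached.
    mutual
      explore : ℕ → Box n → List (Triple n) → Prog n Outcome
      explore zero    β K = pure (finished K)
      explore (suc f) β K = exploreWith f β K (any? (λ u → u ∈ᴮ β Bool.≟ true) (orderings K))

      exploreWith : ℕ → (β : Box n) (K : List (Triple n)) →
                    Dec (Any (λ u → u ∈ᴮ β ≡ true) (orderings K)) → Prog n Outcome
      exploreWith f β K (yes known) = exploreAll f (pieces (proj₁ (find known)) β) K
      exploreWith f β K (no _)      = askBox β >>= onAnswer f β K

      onAnswer : ℕ → Box n → List (Triple n) → Bool → Prog n Outcome
      onAnswer f β K false = pure (finished K)
      onAnswer f β K true  = findTriangle β >>= onFound f β K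

      onFound : ℕ → Box n → List (Triple n) → Maybe (Triple n) → Prog n Outcome
      onFound f β K nothing  = pure (finished K)
      onFound f β K (just u) with length K <? τ
      ... | yes _ = exploreAll f (pieces u β) (sort u ∷ K)
      ... | no  _ = pure (overflow (sort u ∷ K))

      exploreAll : ℕ → List (Box n) → List (Triple n) → Prog n Outcome
      exploreAll f []       K = pure (finished K)
      exploreAll f (β ∷ βs) K = explore f β K >>= continue f βs

      continue : ℕ → List (Box n) → Outcome → Prog n Outcome
      continue f βs (finished K) = exploreAll f βs K
      continue f βs (overflow K) = pure (overflow K)

    code : ℕ → ℕ → Fin n → Code
    code i j v = bitOf i v , bitOf j v

    root : ℕ × ℕ × Code × Code × Code → Box n
    root (i , j , c₁ , c₂ , c₃) = colouring (classify c₁ c₂ c₃ ∘ code i j)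

    roots : List (Box n)
    roots = map root (cartesianProduct (upTo k) (cartesianProduct (upTo k)
                     (cartesianProduct codes (cartesianProduct codes codes))))

    report : Outcome → Output
    report (finished K) = estimate (ℕ→ℚ (length K))
    report (overflow K) = large

    fuel : ℕ
    fuel = suc (n + n + n)

    algorithm : Prog n Output
    algorithm = exploreAll fuel roots [] >>= pure ∘ report

  ℕ→ℚ≡mkℚ : ∀ m → ℕ→ℚ m ≡ mkℚ (ℤ.+ m) 0 (Coprimality.sym (Coprimality.1-coprimeTo m))
  ℕ→ℚ≡mkℚ m = ℚP.normalize-coprime (Coprimality.sym (Coprimality.1-coprimeTo m))

  ℕ→ℚ-mono-≤ : ∀ {m n} → m ℕ.≤ n → ℕ→ℚ m ℚ.≤ ℕ→ℚ n
  ℕ→ℚ-mono-≤ {m} {n} m≤n rewrite ℕ→ℚ≡mkℚ m | ℕ→ℚ≡mkℚ n =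
    ℚ.*≤* (subst₂ ℤ._≤_ (sym (ℤP.*-identityʳ (ℤ.+ m))) (sym (ℤP.*-identityʳ (ℤ.+ n))) (ℤ.+≤+ m≤n))

  ℕ→ℚ-nonNeg : ∀ m → 0ℚ ℚ.≤ ℕ→ℚ m
  ℕ→ℚ-nonNeg m = ℕ→ℚ-mono-≤ {0} {m} z≤n

  exact-estimate : ∀ {ε} → 0ℚ ℚ.< ε → ∀ m → ∣ ℕ→ℚ m - ℕ→ℚ m ∣ ℚ.≤ ε ℚ.* ℕ→ℚ m
  exact-estimate {ε} 0<ε m =
    subst (ℚ._≤ ε ℚ.* ℕ→ℚ m) (trans (ℚP.*-zeroʳ ε) (cong ∣_∣ (sym (ℚP.+-inverseʳ (ℕ→ℚ m)))))
      (ℚP.*-monoˡ-≤-nonNeg ε {{ℚ.nonNegative (ℚP.<⇒≤ 0<ε)}} (ℕ→ℚ-nonNeg m))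

  budget-ℚ : ∀ {ε} → 0ℚ ℚ.< ε → ε ℚ.< 1ℚ → ∀ {q B} → q ℕ.≤ B → ℕ→ℚ q ℚ.* (ε ℚ.* ε) ℚ.≤ ℕ→ℚ B
  budget-ℚ {ε} 0<ε ε<1 {q} q≤B = ℚP.≤-trans q·ε²≤q (ℕ→ℚ-mono-≤ q≤B)
    where
    instance
      ε-nonNeg : ℚ.NonNegative ε
      ε-nonNeg = ℚ.nonNegative (ℚP.<⇒≤ 0<ε)
      q-nonNeg : ℚ.NonNegative (ℕ→ℚ q)
      q-nonNeg = ℚ.nonNegative (ℕ→ℚ-nonNeg q)
    ε²≤1 : ε ℚ.* ε ℚ.≤ 1ℚ
    ε²≤1 = ℚP.≤-trans (ℚP.*-monoˡ-≤-nonNeg ε (ℚP.<⇒≤ ε<1))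
                      (ℚP.≤-trans (ℚP.≤-reflexive (ℚP.*-identityʳ ε)) (ℚP.<⇒≤ ε<1))
    q·ε²≤q : ℕ→ℚ q ℚ.* (ε ℚ.* ε) ℚ.≤ ℕ→ℚ q
    q·ε²≤q = ℚP.≤-trans (ℚP.*-monoˡ-≤-nonNeg (ℕ→ℚ q) ε²≤1) (ℚP.≤-reflexive (ℚP.*-identityʳ (ℕ→ℚ q)))

  no-failure : ∀ x → (1ℚ - 1ℚ) ℚ.* x ℚ.≤ 1ℚ
  no-failure x = subst (ℚ._≤ 1ℚ) (sym (trans (cong (ℚ._* x) (ℚP.+-inverseʳ 1ℚ)) (ℚP.*-zeroˡ x)))
                   (ℚP.<⇒≤ (ℚP.positive⁻¹ 1ℚ))

  m≤m*m : ∀ m → m ℕ.≤ m * m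
  m≤m*m zero    = z≤n
  m≤m*m (suc m) = ℕP.m≤m*n (suc m) (suc m)

  length-cartesianProduct : (xs : List A) (ys : List B) →
                            length (cartesianProduct xs ys) ≡ length xs * length ys
  length-cartesianProduct []       ys = refl
  length-cartesianProduct (x ∷ xs) ys =
    trans (ListP.length-++ (map (x ,_) ys))
          (cong₂ _+_ (ListP.length-map (x ,_) ys) (length-cartesianProduct xs ys))

  other-bit : ∀ {x y : Bool} → x ≢ y → ∀ z → z ≡ x ⊎ z ≡ y
  other-bit {true}  {true}  x≢y _     = ⊥-elim (x≢y refl)
  other-bit {false} {false} x≢y _     = ⊥-elim (x≢y refl)
  other-bit {true}  {false} _   true  = inj₁ refl
  other-bit {true}  {false} _   false = inj₂ refl
  other-bit {false} {true}  _   true  = inj₂ refl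
  other-bit {false} {true}  _   false = inj₁ refl

  first≢ : ∀ {x x′ : A} {y y′ : B} → x ≢ x′ → (x , y) ≢ (x′ , y′)
  first≢ x≢x′ = x≢x′ ∘ cong proj₁

  second≢ : ∀ {x x′ : A} {y y′ : B} → y ≢ y′ → (x , y) ≢ (x′ , y′)
  second≢ y≢y′ = y≢y′ ∘ cong proj₂

  -- The 64⌈log₂ n⌉² root boxes cost at most 1 + 18 (τ + 1) ≤ 37 max(1, τ) queries each, and the
  -- 3⌈log₂ n⌉ queries per triangle found add at most 6 max(1, τ) ⌈log₂ n⌉².
  C : ℕ
  C = 2374

  -- Correctness

  module Correctness (n τ : ℕ) (G : Graph n) where
    open Algorithm n τ
    open import Data.List.Membership.DecPropositional (_≟ᵀ_ {n = n}) using (_∈?_)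

    vertices-separated : ∀ {v w : Fin n} → v ≢ w → ∃[ i ] i < k × bitOf i v ≢ bitOf i w
    vertices-separated {v} {w} v≢w =
      bits-separate k (below v) (below w) (v≢w ∘ FinP.toℕ-injective)
      where
      below : ∀ v → toℕ v < 2 ℕ.^ k
      below v = ℕP.<-≤-trans (FinP.toℕ<n v) (n≤2^⌈log₂n⌉ n)

    agreeing-vertices-equal : ∀ {v w : Fin n} → (∀ i → i < k → bitOf i v ≡ bitOf i w) → v ≡ w
    agreeing-vertices-equal {v} {w} agree with v FinP.≟ w
    ... | yes v≡w = v≡w
    ... | no  v≢w = let i , i<k , bits≢ = vertices-separated v≢w in ⊥-elim (bits≢ (agree i i<k))

    Agree : Role → ℕ → Box n → Set
    Agree r i β = ∀ u w → u ∈ᴮ β ≡ true → w ∈ᴮ β ≡ true → bitOf i (u at r) ≡ bitOf i (w at r)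

    Agree-⊆ : ∀ {r i} β′ β → β′ ⊆ᴮ β → Agree r i β → Agree r i β′
    Agree-⊆ β′ β β′⊆β agree u w u∈ w∈ = agree u w (β′⊆β u u∈) (β′⊆β w w∈)

    Narrowed : Role → ℕ → Box n → Box n → ℕ → Set
    Narrowed r m β β′ q = q ≤ m × HasTriangle G β′ × β′ ⊆ᴮ β × (∀ i → i < m → Agree r i β′)

    narrow-spec : ∀ r i β → HasTriangle G β →
      Runs G (narrow r i β) λ β′ q → q ≤ 1 × HasTriangle G β′ × β′ ⊆ᴮ β × Agree r i β′
    narrow-spec r i β (w , w∈β , tri) = Runs->>= G (askBox β₁) (askBox-spec G β₁) choose
      where
      β₁ = restrict r (bitOf i) β
      β₀ = restrict r (not ∘ bitOf i) β
      choose : ∀ b q → q ≤ 1 × Reflects (HasTriangle G β₁) b →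
               q + 0 ≤ 1 × HasTriangle G (if b then β₁ else β₀) × (if b then β₁ else β₀) ⊆ᴮ β ×
               Agree r i (if b then β₁ else β₀)
      choose true  q (q≤1 , ofʸ has₁) =
        subst (_≤ 1) (sym (ℕP.+-identityʳ q)) q≤1 , has₁ , restrict-⊆ r _ β ,
        λ u v u∈ v∈ → trans (restrict-sat r _ β u u∈) (sym (restrict-sat r _ β v v∈))
      choose false q (q≤1 , ofⁿ ¬has₁) =
        subst (_≤ 1) (sym (ℕP.+-identityʳ q)) q≤1 , (w , ∈-restrict r _ β w w∈β bit₀ , tri) , restrict-⊆ r _ β ,
        λ u v u∈ v∈ → BoolP.not-injective (trans (restrict-sat r _ β u u∈) (sym (restrict-sat r _ β v v∈)))
        where
        bit₀ : not (bitOf i (w at r)) ≡ true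
        bit₀ with bitOf i (w at r) in bit≡
        ... | true  = ⊥-elim (¬has₁ (w , ∈-restrict r _ β w w∈β bit≡ , tri))
        ... | false = refl

    narrowAll-spec : ∀ r m β → HasTriangle G β → Runs G (narrowAll r m β) (Narrowed r m β)
    narrowAll-spec r zero    β has = z≤n , has , (λ _ u∈ → u∈) , λ _ ()
    narrowAll-spec r (suc i) β has =
      Runs->>= G (narrow r i β) (narrow-spec r i β has) λ β₁ q₁ (q₁≤1 , has₁ , β₁⊆β , agree₁) →
      Runs-mono G (narrowAll r i β₁) (λ β′ q₂ (q₂≤i , has′ , β′⊆β₁ , agree′) →
          ℕP.+-mono-≤ q₁≤1 q₂≤i , has′ , (λ u → β₁⊆β u ∘ β′⊆β₁ u) , λ j j<1+i →
          [ agree′ j , (λ { refl → Agree-⊆ {r} {j} β′ β₁ β′⊆β₁ agree₁ }) ]′ (ℕP.m<1+n⇒m<n∨m≡n j<1+i))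
        (narrowAll-spec r i β₁ has₁)

    pick-spec : ∀ β → HasTriangle G β → (∀ r i → i < k → Agree r i β) →
                ∃ λ u → pick β ≡ just u × u ∈ᴮ β ≡ true × Tri G u ≡ true
    pick-spec β has@(w , w∈β , tri) agree with inhabited? β
    ... | yes ((a , a∈) , (b , b∈) , (c , c∈)) =
      (a , b , c) , refl , u∈β , subst (λ v → Tri G v ≡ true) (sym u≡w) tri
      where
      u∈β : (a , b , c) ∈ᴮ β ≡ true
      u∈β = cong₂ _∧_ a∈ (cong₂ _∧_ b∈ c∈)
      same : ∀ r → (a , b , c) at r ≡ w at r
      same r = agreeing-vertices-equal λ i i<k → agree r i i<k (a , b , c) w u∈β w∈β
      u≡w : (a , b , c) ≡ w
      u≡w = cong₂ _,_ (same first) (cong₂ _,_ (same second) (same third))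
    ... | no ¬inh = ⊥-elim (¬inh (HasTriangle⇒Inhabited G β has))

    Found : Box n → Maybe (Triple n) → ℕ → Set
    Found β res q = q ≤ 3 * k × ∃ λ u → res ≡ just u × u ∈ᴮ β ≡ true × Tri G u ≡ true

    findTriangle-spec : ∀ β → HasTriangle G β → Runs G (findTriangle β) (Found β)
    findTriangle-spec β has =
      Runs->>= G (narrowAll first k β) (narrowAll-spec first k β has) λ β₁ q₁ (q₁≤k , has₁ , β₁⊆β , agree₁) →
      Runs->>= G (narrowAll second k β₁) (narrowAll-spec second k β₁ has₁) λ β₂ q₂ (q₂≤k , has₂ , β₂⊆β₁ , agree₂) →
      Runs->>= G (narrowAll third k β₂) (narrowAll-spec third k β₂ has₂) λ β₃ q₃ (q₃≤k , has₃ , β₃⊆β₂ , agree₃) →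
      let β₃⊆β₁ : β₃ ⊆ᴮ β₁
          β₃⊆β₁ = λ u → β₂⊆β₁ u ∘ β₃⊆β₂ u
          agree : ∀ r i → i < k → Agree r i β₃
          agree = λ { first  i i<k → Agree-⊆ {first} {i} β₃ β₁ β₃⊆β₁ (agree₁ i i<k)
                    ; second i i<k → Agree-⊆ {second} {i} β₃ β₂ β₃⊆β₂ (agree₂ i i<k)
                    ; third  i i<k → agree₃ i i<k }
          u , picked , u∈β₃ , tri = pick-spec β₃ has₃ agree
      in ℕP.+-mono-≤ q₁≤k (ℕP.+-mono-≤ q₂≤k (ℕP.+-monoˡ-≤ 0 q₃≤k)) ,
         u , picked , β₁⊆β u (β₃⊆β₁ u u∈β₃) , tri

    IsTriangleList : List (Triple n) → Set
    IsTriangleList K = Unique K × All (λ κ → OrderedTriangle G κ ≡ true) K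

    Complete : Box n → List (Triple n) → Set
    Complete β K = ∀ u → u ∈ᴮ β ≡ true → Tri G u ≡ true → sort u ∈ K

    Status : (List (Triple n) → Set) → Outcome → Set
    Status Done (finished K) = length K ≤ τ × Done K
    Status Done (overflow K) = length K ≡ suc τ

    Explored : (List (Triple n) → Set) → (List (Triple n) → ℕ) → List (Triple n) → Outcome → ℕ → Set
    Explored Done budget K o q = Σ (List (Triple n)) λ new →
      triangles o ≡ new ++ K × IsTriangleList (triangles o) × q ≤ budget (triangles o) + 3 * k * length new ×
      Status Done o

    boxCost : List (Triple n) → Box n → ℕ
    boxCost K β = 1 + 3 * copies β K

    ExploredBox : Box n → List (Triple n) → Outcome → ℕ → Set
    ExploredBox β = Explored (Complete β) (λ K′ → boxCost K′ β)

    ExploredBoxes : List (Box n) → List (Triple n) → Outcome → ℕ → Set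
    ExploredBoxes βs = Explored (λ K′ → All (λ β → Complete β K′) βs) (λ K′ → Σₗ (boxCost K′) βs)

    Explored-weaken : ∀ {Done B B′ K o q} → (∀ K′ → B K′ ≤ B′ K′) →
                      Explored Done B K o q → Explored Done B′ K o q
    Explored-weaken B≤B′ (new , eq , valid , cost , status) =
      new , eq , valid , ℕP.≤-trans cost (ℕP.+-monoˡ-≤ (3 * k * length new) (B≤B′ _)) , status

    ∈-orderings-++ : ∀ (new K : List (Triple n)) {u} → u ∈ orderings K → u ∈ orderings (new ++ K)
    ∈-orderings-++ new K u∈ with κ , κ∈K , u∈κ ← ∈-orderings⁻ K u∈ = ∈-orderings⁺ (∈-++⁺ʳ new κ∈K) u∈κ

    sort-known : ∀ (K : List (Triple n)) → IsTriangleList K → ∀ {w} → w ∈ orderings K → sort w ∈ K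
    sort-known K (_ , ordered) w∈ with (a , b , c) , κ∈K , w∈κ ← ∈-orderings⁻ K w∈ =
      subst (_∈ K) (sym (sort-permutation a<b b<c w∈κ)) κ∈K
      where
      κ-ordered = All.lookup ordered κ∈K
      a<b = BoolP.∧-conicalˡ _ _ κ-ordered
      b<c = BoolP.∧-conicalˡ _ _ (BoolP.∧-conicalʳ (a <ᵛ b) _ κ-ordered)

    pieces-cost : ∀ w β K′ → w ∈ᴮ β ≡ true → w ∈ orderings K′ → Σₗ (boxCost K′) (pieces w β) ≤ 3 * copies β K′
    pieces-cost w β K′ w∈β w∈K′ = begin
      (1 + 3 * c₁) + ((1 + 3 * c₂) + ((1 + 3 * c₃) + 0)) ≡⟨ regroup c₁ c₂ c₃ ⟩
      3 * (c₁ + (c₂ + (c₃ + 1)))                          ≤⟨ ℕP.*-monoʳ-≤ 3 (copies-pieces w β K′ w∈β w∈K′) ⟩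
      3 * copies β K′                                      ∎
      where
      open ℕP.≤-Reasoning
      c₁ = copies (piece₁ w β) K′
      c₂ = copies (piece₂ w β) K′
      c₃ = copies (piece₃ w β) K′
      regroup : ∀ x y z → (1 + 3 * x) + ((1 + 3 * y) + ((1 + 3 * z) + 0)) ≡ 3 * (x + (y + (z + 1)))
      regroup = solve-∀

    explored-pieces : ∀ w β K₀ {o q} → w ∈ᴮ β ≡ true → sort w ∈ K₀ → w ∈ orderings K₀ →
      ExploredBoxes (pieces w β) K₀ o q →
      Explored (Complete β) (λ K′ → 3 * copies β K′) K₀ o q
    explored-pieces w β K₀ {o} w∈β sort∈K₀ w∈K₀ (new , eq , valid , cost , status) =
      new , eq , valid , ℕP.≤-trans cost (ℕP.+-monoˡ-≤ _ (pieces-cost w β (triangles o) w∈β w∈K′)) ,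
      complete o eq status
      where
      w∈K′ : w ∈ orderings (triangles o)
      w∈K′ = subst (λ K′ → w ∈ orderings K′) (sym eq) (∈-orderings-++ new K₀ w∈K₀)
      complete : ∀ o → triangles o ≡ new ++ K₀ → Status (λ K′ → All (λ p → Complete p K′) (pieces w β)) o →
                 Status (Complete β) o
      complete (overflow K′) _  len = len
      complete (finished K′) K′≡ (len , pieces-complete) = len , λ u u∈β tri → cover u u∈β tri (u ≟ᵀ w)
        where
        cover : ∀ u → u ∈ᴮ β ≡ true → Tri G u ≡ true → Dec (u ≡ w) → sort u ∈ K′
        cover u u∈β tri (yes refl) = subst (sort u ∈_) (sym K′≡) (∈-++⁺ʳ new sort∈K₀)
        cover u u∈β tri (no u≢w) =
          let p , p∈ , u∈p = find (pieces-cover w β u u∈β u≢w) in All.lookup pieces-complete p∈ u u∈p tri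

    explored-after-found : ∀ {Done B K κ o q₁ q₂ q₃} → q₁ ≤ 1 → q₂ ≤ 3 * k → Explored Done B (κ ∷ K) o q₃ →
                           Explored Done (λ K′ → 1 + B K′) K o (q₁ + (q₂ + q₃))
    explored-after-found {B = B} {K} {κ} {o} {q₁} {q₂} {q₃} q₁≤1 q₂≤3k (new , eq , valid , cost , status) =
      new ++ [ κ ] , trans eq (sym (ListP.++-assoc new [ κ ] K)) , valid , cost′ , status
      where
      open ℕP.≤-Reasoning
      cost′ : q₁ + (q₂ + q₃) ≤ (1 + B (triangles o)) + 3 * k * length (new ++ [ κ ])
      cost′ = begin
        q₁ + (q₂ + q₃)                                       ≤⟨ ℕP.+-mono-≤ q₁≤1 (ℕP.+-mono-≤ q₂≤3k cost) ⟩
        1 + (3 * k + (B (triangles o) + 3 * k * length new))   ≡⟨ regroup k (B (triangles o)) (length new) ⟩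
        (1 + B (triangles o)) + 3 * k * (length new + 1)        ≡⟨ cong (λ m → (1 + B (triangles o)) + 3 * k * m)
                                                                   (ListP.length-++ new) ⟨
        (1 + B (triangles o)) + 3 * k * length (new ++ [ κ ])   ∎
        where
        regroup : ∀ k b m → 1 + (3 * k + (b + 3 * k * m)) ≡ (1 + b) + 3 * k * (m + 1)
        regroup = solve-∀

    cost-sequence : ∀ {q₁ q₂ a a′ b c m₁ m₂} → q₁ ≤ a + c * m₁ → a ≤ a′ → q₂ ≤ b + c * m₂ →
                    q₁ + q₂ ≤ (a′ + b) + c * (m₂ + m₁)
    cost-sequence {q₁} {q₂} {a} {a′} {b} {c} {m₁} {m₂} q₁≤ a≤a′ q₂≤ = begin
      q₁ + q₂                         ≤⟨ ℕP.+-mono-≤ (ℕP.≤-trans q₁≤ (ℕP.+-monoˡ-≤ (c * m₁) a≤a′)) q₂≤ ⟩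
      (a′ + c * m₁) + (b + c * m₂)     ≡⟨ regroup a′ b c m₁ m₂ ⟩
      (a′ + b) + c * (m₂ + m₁)         ∎
      where
      open ℕP.≤-Reasoning
      regroup : ∀ a′ b c m₁ m₂ → (a′ + c * m₁) + (b + c * m₂) ≡ (a′ + b) + c * (m₂ + m₁)
      regroup = solve-∀

    copies-mono : ∀ β new (K : List (Triple n)) → copies β K ≤ copies β (new ++ K)
    copies-mono β new K = subst (copies β K ≤_) (sym (copies-++ β new K)) (ℕP.m≤n+m _ _)

    triangle-list-cons : ∀ K → IsTriangleList K → ∀ {u} → Tri G u ≡ true → sort u ∉ K →
                         IsTriangleList (sort u ∷ K)
    triangle-list-cons K (unique , ordered) {u} tri sort∉K =
      ¬Any⇒All¬ K sort∉K AllPairs.∷ unique , sort-ordered G u tri ∷ ordered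

    sort-unknown : ∀ (K : List (Triple n)) (β : Box n) u →
                   ¬ Any (λ u → u ∈ᴮ β ≡ true) (orderings K) → u ∈ᴮ β ≡ true → sort u ∉ K
    sort-unknown K β u unknown u∈β sort∈K =
      unknown (lose (∈-orderings⁺ {K = K} sort∈K (∈-permutations-sort u)) u∈β)

    mutual
      explore-spec : ∀ f β K → IsTriangleList K → length K ≤ τ → size β < f →
                     Runs G (explore f β K) (ExploredBox β K)
      explore-spec (suc f) β K valid len (s≤s size≤f) =
        exploreWith-spec f β K valid len size≤f (any? (λ u → u ∈ᴮ β Bool.≟ true) (orderings K))

      exploreWith-spec : ∀ f β K → IsTriangleList K → length K ≤ τ → size β ≤ f → ∀ known? →
                         Runs G (exploreWith f β K known?) (ExploredBox β K)
      exploreWith-spec f β K valid len size≤f (yes known) = cut-known-spec f β K valid len size≤f (find known)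
      exploreWith-spec f β K valid len size≤f (no unknown) =
        Runs->>= G (askBox β) (askBox-spec G β) (onAnswer-spec f β K valid len size≤f unknown)

      cut-known-spec : ∀ f β K → IsTriangleList K → length K ≤ τ → size β ≤ f →
        (hit : ∃ λ w → w ∈ orderings K × w ∈ᴮ β ≡ true) →
        Runs G (exploreAll f (pieces (proj₁ hit) β) K) (ExploredBox β K)
      cut-known-spec f β K valid len size≤f (w , w∈K , w∈β) =
        Runs-mono G (exploreAll f (pieces w β) K)
          (λ o q → Explored-weaken {B = λ K′ → 3 * copies β K′} (λ K′ → ℕP.m≤n+m _ 1)
                   ∘ explored-pieces w β K w∈β (sort-known K valid w∈K) w∈K)
          (exploreAll-spec f (pieces w β) K valid len
             (All.tabulate λ p∈ → ℕP.<-≤-trans (pieces-shrink w β w∈β p∈) size≤f))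

      onAnswer-spec : ∀ f β K → IsTriangleList K → length K ≤ τ → size β ≤ f →
        ¬ Any (λ u → u ∈ᴮ β ≡ true) (orderings K) → ∀ b q₁ → q₁ ≤ 1 × Reflects (HasTriangle G β) b →
        Runs G (onAnswer f β K b) λ o q → ExploredBox β K o (q₁ + q)
      onAnswer-spec f β K valid len size≤f unknown false q₁ (q₁≤1 , ofⁿ ¬has) =
        [] , refl , valid ,
        ℕP.≤-trans (ℕP.≤-trans (ℕP.≤-reflexive (ℕP.+-identityʳ q₁)) q₁≤1)
          (ℕP.≤-trans (ℕP.m≤m+n 1 (3 * copies β K)) (ℕP.m≤m+n (boxCost K β) (3 * k * 0))) ,
        len , λ u u∈β tri → ⊥-elim (¬has (u , u∈β , tri))
      onAnswer-spec f β K valid len size≤f unknown true q₁ (q₁≤1 , ofʸ has) =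
        Runs->>= G (findTriangle β) (findTriangle-spec β has) λ where
          .(just u) q₂ (q₂≤3k , u , refl , u∈β , tri) →
            onFound-spec f β K len size≤f u u∈β
              (triangle-list-cons K valid tri (sort-unknown K β u unknown u∈β)) q₁≤1 q₂≤3k

      onFound-spec : ∀ f β K → length K ≤ τ → size β ≤ f → ∀ u → u ∈ᴮ β ≡ true →
        IsTriangleList (sort u ∷ K) → ∀ {q₁ q₂} → q₁ ≤ 1 → q₂ ≤ 3 * k →
        Runs G (onFound f β K (just u)) λ o q₃ →
          ExploredBox β K o (q₁ + (q₂ + q₃))
      onFound-spec f β K len size≤f u u∈β valid′ {q₁} {q₂} q₁≤1 q₂≤3k with length K <? τ
      ... | yes len<τ =
        Runs-mono G (exploreAll f (pieces u β) (sort u ∷ K))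
          (λ o q₃ → explored-after-found {B = λ K′ → 3 * copies β K′} q₁≤1 q₂≤3k
                     ∘ explored-pieces u β (sort u ∷ K) u∈β (here refl)
                         (∈-orderings⁺ {K = sort u ∷ K} (here refl) (∈-permutations-sort u)))
          (exploreAll-spec f (pieces u β) (sort u ∷ K) valid′ len<τ
             (All.tabulate λ p∈ → ℕP.<-≤-trans (pieces-shrink u β u∈β p∈) size≤f))
      ... | no len≮τ =
        [ sort u ] , refl , valid′ , overflow-cost , cong suc (ℕP.≤-antisym len (ℕP.≮⇒≥ len≮τ))
        where
        open ℕP.≤-Reasoning
        c = copies β (sort u ∷ K)
        overflow-cost : q₁ + (q₂ + 0) ≤ (1 + 3 * c) + 3 * k * 1
        overflow-cost = begin
          q₁ + (q₂ + 0)            ≤⟨ ℕP.+-mono-≤ q₁≤1 (ℕP.+-monoˡ-≤ 0 q₂≤3k) ⟩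
          1 + (3 * k + 0)          ≡⟨ regroup (3 * k) ⟩
          1 + 3 * k * 1            ≤⟨ ℕP.+-monoˡ-≤ (3 * k * 1) (ℕP.m≤m+n 1 (3 * c)) ⟩
          (1 + 3 * c) + 3 * k * 1  ∎
          where
          regroup : ∀ x → 1 + (x + 0) ≡ 1 + x * 1
          regroup = solve-∀

      exploreAll-spec : ∀ f βs K → IsTriangleList K → length K ≤ τ → All (λ β → size β < f) βs →
        Runs G (exploreAll f βs K)
          (ExploredBoxes βs K)
      exploreAll-spec f []       K valid len _ = [] , refl , valid , z≤n , len , []
      exploreAll-spec f (β ∷ βs) K valid len (size< ∷ sizes<) =
        Runs->>= G (explore f β K) (explore-spec f β K valid len size<) (continue-spec f β βs K sizes<)

      continue-spec : ∀ f β βs K → All (λ β → size β < f) βs → ∀ o q₁ →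
        ExploredBox β K o q₁ →
        Runs G (continue f βs o) λ o′ q₂ →
          ExploredBoxes (β ∷ βs) K o′ (q₁ + q₂)
      continue-spec f β βs K sizes< (finished K₁) q₁ (new₁ , refl , valid₁ , cost₁ , len₁ , complete₁) =
        Runs-mono G (exploreAll f βs K₁) extend (exploreAll-spec f βs K₁ valid₁ len₁ sizes<)
        where
        extend : ∀ o′ q₂ → ExploredBoxes βs K₁ o′ q₂ →
                 ExploredBoxes (β ∷ βs) K o′ (q₁ + q₂)
        extend o′ q₂ (new₂ , eq₂ , valid₂ , cost₂ , status₂) =
          new₂ ++ new₁ , trans eq₂ (sym (ListP.++-assoc new₂ new₁ K)) , valid₂ ,
          subst (λ m → q₁ + q₂ ≤ (boxCost K′ β + Σₗ (boxCost K′) βs) + 3 * k * m) (sym (ListP.length-++ new₂))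
            (cost-sequence {a′ = boxCost K′ β} {b = Σₗ (boxCost K′) βs} {c = 3 * k} {m₂ = length new₂}
               cost₁ (ℕP.+-monoʳ-≤ 1 (ℕP.*-monoʳ-≤ 3 more-copies)) cost₂) ,
          status o′ eq₂ status₂
          where
          K′ = triangles o′
          more-copies : copies β K₁ ≤ copies β K′
          more-copies = subst (λ K″ → copies β K₁ ≤ copies β K″) (sym eq₂) (copies-mono β new₂ K₁)
          status : ∀ o′ → triangles o′ ≡ new₂ ++ K₁ → Status (λ K′ → All (λ β → Complete β K′) βs) o′ →
                   Status (λ K′ → All (λ β → Complete β K′) (β ∷ βs)) o′
          status (overflow K′) _   len′ = len′
          status (finished K′) K′≡ (len′ , complete′) =
            len′ , (λ u u∈β tri → subst (sort u ∈_) (sym K′≡) (∈-++⁺ʳ new₂ (complete₁ u u∈β tri))) ∷ complete′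
      continue-spec f β βs K sizes< (overflow K₁) q₁ (new₁ , refl , valid₁ , cost₁ , len₁) =
        new₁ , refl , valid₁ ,
        ℕP.≤-trans (ℕP.≤-reflexive (ℕP.+-identityʳ q₁))
          (ℕP.≤-trans cost₁ (ℕP.+-monoˡ-≤ (3 * k * length new₁)
                                (ℕP.m≤m+n (boxCost (new₁ ++ K) β) (Σₗ (boxCost (new₁ ++ K)) βs)))) ,
        len₁

    count-list : ∀ K → Unique K → Σ³ (λ u → ⟦ does (u ∈? K) ⟧) ≡ length K
    count-list []      _                     = Σ³-zero {f = λ u → ⟦ does (u ∈? []) ⟧} λ _ → refl
    count-list (κ ∷ K) (κ∉K AllPairs.∷ unique) = begin
      Σ³ (λ u → ⟦ does (u ∈? κ ∷ K) ⟧)        ≡⟨ Σ³-cong split ⟩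
      Σ³ (λ u → at-κ u + in-K u)               ≡⟨ Σ³-distrib-+ at-κ in-K ⟩
      Σ³ at-κ + Σ³ in-K                        ≡⟨ cong₂ _+_ point (count-list K unique) ⟩
      1 + length K                             ∎
      where
      open ≡-Reasoning
      at-κ in-K : Triple n → ℕ
      at-κ u = ⟦ does (u ≟ᵀ κ) ⟧
      in-K u = ⟦ does (u ∈? K) ⟧
      point : Σ³ at-κ ≡ 1
      point = trans (Σ³-single κ λ u u≢κ → cong ⟦_⟧ (dec-false (u ≟ᵀ κ) u≢κ))
                    (cong ⟦_⟧ (dec-true (κ ≟ᵀ κ) refl))
      split : ∀ u → ⟦ does (u ∈? κ ∷ K) ⟧ ≡ at-κ u + in-K u
      split u with u ≟ᵀ κ | u ∈? K
      ... | yes refl | yes κ∈K = ⊥-elim (All¬⇒¬Any κ∉K κ∈K)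
      ... | yes refl | no  _   = refl
      ... | no  _    | yes _   = refl
      ... | no  _    | no  _   = refl

    length≤t : ∀ K → IsTriangleList K → length K ℕ.≤ t G
    length≤t K (unique , ordered) =
      subst (ℕ._≤ t G) (count-list K unique) (Σ³-mono-≤ listed≤ordered)
      where
      listed≤ordered : ∀ u → ⟦ does (u ∈? K) ⟧ ℕ.≤ ⟦ OrderedTriangle G u ⟧
      listed≤ordered u with u ∈? K
      ... | yes u∈K rewrite All.lookup ordered u∈K = ℕP.≤-refl
      ... | no  _   = z≤n

    length≡t : ∀ K → IsTriangleList K → (∀ u → OrderedTriangle G u ≡ true → u ∈ K) → length K ≡ t G
    length≡t K (unique , ordered) all-listed =
      trans (sym (count-list K unique)) (Σ³-cong λ u → cong ⟦_⟧ (listed≡ordered u))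
      where
      listed≡ordered : ∀ u → does (u ∈? K) ≡ OrderedTriangle G u
      listed≡ordered u with OrderedTriangle G u in ord
      ... | true  = dec-true (u ∈? K) (all-listed u ord)
      ... | false = dec-false (u ∈? K) λ u∈K → case (trans (sym (All.lookup ordered u∈K)) ord)
        where
        case : true ≢ false
        case ()

    separating-codes : ∀ {a b c} → a ≢ b → b ≢ c → a ≢ c →
      ∃₂ λ i j → i ℕ.< k × j ℕ.< k × code i j a ≢ code i j b × code i j b ≢ code i j c × code i j a ≢ code i j c
    separating-codes {a} {b} {c} a≢b b≢c a≢c
      with i , i<k , aᵢ≢bᵢ ← vertices-separated a≢b | other-bit aᵢ≢bᵢ (bitOf i c)
    ... | inj₁ cᵢ≡aᵢ = let j , j<k , aⱼ≢cⱼ = vertices-separated a≢c in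
      i , j , i<k , j<k , first≢ aᵢ≢bᵢ , first≢ (λ bᵢ≡cᵢ → aᵢ≢bᵢ (sym (trans bᵢ≡cᵢ cᵢ≡aᵢ))) , second≢ aⱼ≢cⱼ
    ... | inj₂ cᵢ≡bᵢ = let j , j<k , bⱼ≢cⱼ = vertices-separated b≢c in
      i , j , i<k , j<k , first≢ aᵢ≢bᵢ , second≢ bⱼ≢cⱼ , first≢ (λ aᵢ≡cᵢ → aᵢ≢bᵢ (trans aᵢ≡cᵢ cᵢ≡bᵢ))

    covered : ∀ {a b c} → a ≢ b → b ≢ c → a ≢ c → ∃ λ β → β ∈ roots × (a , b , c) ∈ᴮ β ≡ true
    covered {a} {b} {c} a≢b b≢c a≢c
      with i , j , i<k , j<k , ab , bc , ac ← separating-codes a≢b b≢c a≢c =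
      root (i , j , c₁ , c₂ , c₃) ,
      ∈-map⁺ root (∈-cartesianProduct⁺ (∈-upTo⁺ i<k) (∈-cartesianProduct⁺ (∈-upTo⁺ j<k)
        (∈-cartesianProduct⁺ (∈-codes c₁) (∈-cartesianProduct⁺ (∈-codes c₂) (∈-codes c₃))))) ,
      cong₂ _∧_ (classify-first c₁ c₂ c₃)
        (cong₂ _∧_ (classify-second c₁ c₂ c₃ (ab ∘ sym)) (classify-third c₁ c₂ c₃ (ac ∘ sym) (bc ∘ sym)))
      where
      c₁ = code i j a
      c₂ = code i j b
      c₃ = code i j c

    all-found : ∀ K → All (λ β → Complete β K) roots → ∀ u → OrderedTriangle G u ≡ true → u ∈ K
    all-found K complete (a , b , c) ordered =
      let a≢b , b≢c , a≢c = Tri⇒distinct G tri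
          β , β∈roots , u∈β = covered a≢b b≢c a≢c
      in subst (_∈ K) (sort-permutation a<b b<c (here refl)) (All.lookup complete β∈roots (a , b , c) u∈β tri)
      where
      a<b = BoolP.∧-conicalˡ (a <ᵛ b) _ ordered
      b<c = BoolP.∧-conicalˡ (b <ᵛ c) _ (BoolP.∧-conicalʳ (a <ᵛ b) _ ordered)
      tri = BoolP.∧-conicalʳ (b <ᵛ c) _ (BoolP.∧-conicalʳ (a <ᵛ b) _ ordered)

    length-roots : length roots ≡ k * (k * 64)
    length-roots =
      trans (ListP.length-map root (cartesianProduct (upTo k) indices))
        (trans (length-cartesianProduct (upTo k) indices)
          (cong₂ _*_ (ListP.length-upTo k)
            (trans (length-cartesianProduct (upTo k) colours)
              (cong₂ _*_ (ListP.length-upTo k)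
                (trans (length-cartesianProduct codes (cartesianProduct codes codes))
                       (cong (4 *_) (length-cartesianProduct codes codes)))))))
      where
      colours = cartesianProduct codes (cartesianProduct codes codes)
      indices = cartesianProduct (upTo k) colours

    total-cost : ∀ {K new : List (Triple n)} {q} → length K ℕ.≤ suc τ → length new ℕ.≤ length K →
                 q ℕ.≤ Σₗ (boxCost K) roots + 3 * k * length new → q ℕ.≤ C * (1 ⊔ τ) * (k * k)
    total-cost {K} {new} {q} K≤1+τ new≤K q≤ = begin
      q
        ≤⟨ q≤ ⟩
      Σₗ (boxCost K) roots + 3 * k * length new
        ≤⟨ ℕP.+-mono-≤ roots-cost (ℕP.*-monoʳ-≤ (3 * k) (ℕP.≤-trans new≤K K≤2T)) ⟩
      k * (k * 64) * (T + 3 * ((T + T) * 6)) + 3 * k * (T + T)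
        ≡⟨ regroup k T ⟩
      2368 * T * (k * k) + 6 * T * k
        ≤⟨ ℕP.+-monoʳ-≤ (2368 * T * (k * k)) (ℕP.*-monoʳ-≤ (6 * T) (m≤m*m k)) ⟩
      2368 * T * (k * k) + 6 * T * (k * k)
        ≡⟨ regroup′ k T ⟩
      2374 * T * (k * k)
        ∎
      where
      open ℕP.≤-Reasoning
      T = 1 ⊔ τ
      K≤2T : length K ℕ.≤ T + T
      K≤2T = ℕP.≤-trans K≤1+τ (ℕP.+-mono-≤ (ℕP.m≤m⊔n 1 τ) (ℕP.m≤n⊔m 1 τ))
      roots-cost : Σₗ (boxCost K) roots ℕ.≤ k * (k * 64) * (T + 3 * ((T + T) * 6))
      roots-cost = begin
        Σₗ (boxCost K) roots
          ≤⟨ Σₗ-bounded (λ β → ℕP.+-monoʳ-≤ 1 (ℕP.*-monoʳ-≤ 3 (copies≤ β K))) roots ⟩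
        length roots * (1 + 3 * (length K * 6))
          ≡⟨ cong (_* (1 + 3 * (length K * 6))) length-roots ⟩
        k * (k * 64) * (1 + 3 * (length K * 6))
          ≤⟨ ℕP.*-monoʳ-≤ (k * (k * 64)) (ℕP.+-mono-≤ (ℕP.m≤m⊔n 1 τ) (ℕP.*-monoʳ-≤ 3 (ℕP.*-monoˡ-≤ 6 K≤2T))) ⟩
        k * (k * 64) * (T + 3 * ((T + T) * 6))
          ∎
      regroup : ∀ k T → k * (k * 64) * (T + 3 * ((T + T) * 6)) + 3 * k * (T + T)
                          ≡ 2368 * T * (k * k) + 6 * T * k
      regroup = solve-∀
      regroup′ : ∀ k T → 2368 * T * (k * k) + 6 * T * (k * k) ≡ 2374 * T * (k * k)
      regroup′ = solve-∀

    algorithm-succeeds : ∀ {ε} → 0ℚ ℚ.< ε → ε ℚ.< 1ℚ → Runs G algorithm (Success G C τ ε)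
    algorithm-succeeds {ε} 0<ε ε<1 =
      Runs->>= G (exploreAll fuel roots [])
        (exploreAll-spec fuel roots [] (AllPairs.[] , []) z≤n (All.tabulate λ {β} _ → s≤s (size≤ β)))
        succeeds
      where
      within-budget : ∀ {K new q} → K ≡ new ++ [] → length K ℕ.≤ suc τ →
                      q ℕ.≤ Σₗ (boxCost K) roots + 3 * k * length new → WithinBudget C n τ ε (q + 0)
      within-budget {K} {new} {q} K≡ K≤1+τ cost =
        budget-ℚ 0<ε ε<1 (ℕP.≤-trans (ℕP.≤-reflexive (ℕP.+-identityʳ q)) (total-cost {K} {new} K≤1+τ new≤K cost))
        where
        new≤K : length new ℕ.≤ length K
        new≤K = subst (λ L → length new ℕ.≤ length L) (sym K≡) (ListP.length-++-≤ˡ new)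
      succeeds : ∀ o q → ExploredBoxes roots [] o q →
                 Success G C τ ε (report o) (q + 0)
      succeeds (finished K) q (new , K≡ , valid , cost , K≤τ , complete) =
        ok-estimate (ℕ→ℚ (length K)) (subst (ℕ._≤ τ) K≡t K≤τ)
          (subst (λ m → ∣ ℕ→ℚ m - ℕ→ℚ (t G) ∣ ℚ.≤ ε ℚ.* ℕ→ℚ (t G)) (sym K≡t) (exact-estimate 0<ε (t G))) ,
        within-budget K≡ (ℕP.≤-trans K≤τ (ℕP.n≤1+n τ)) cost
        where
        K≡t = length≡t K valid (all-found K complete)
      succeeds (overflow K) q (new , K≡ , valid , cost , K≡1+τ) =
        ok-large (subst (ℕ._≤ t G) K≡1+τ (length≤t K valid)) ,
        within-budget K≡ (ℕP.≤-reflexive K≡1+τ) cost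

  success-probability≡1 : ∀ n τ (G : Graph n) {ε} → 0ℚ ℚ.< ε → ε ℚ.< 1ℚ →
    Pr G (Success G C τ ε) (Success? G C τ ε) (toAlg (Algorithm.algorithm n τ)) 0 ≡ 1ℚ
  success-probability≡1 n τ G 0<ε ε<1 =
    Pr≡1 G _ (Success? G C τ _) (Algorithm.algorithm n τ) 0 (Correctness.algorithm-succeeds n τ G 0<ε ε<1)

open import Data.Nat using (ℕ; _^_)
open import Data.Rational using (ℚ; 0ℚ; 1ℚ; _<_; _≤_; _*_; _-_)
open import Data.Product using (Σ; _×_; _,_)
open import Relation.Binary.PropositionalEquality using (subst; sym)
open Counting using (toAlg; no-failure; module Algorithm; success-probability≡1)

lemma2 : Σ ((n τ : ℕ) (ε : ℚ) → Alg n) λ alg →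
         Σ ℕ λ C →
         ∀ (n : ℕ) (G : Graph n) (τ : ℕ) (ε : ℚ) →
           0ℚ < ε → ε < 1ℚ →
           (1ℚ - Pr G (Success G C τ ε) (Success? G C τ ε) (alg n τ ε) 0)
             * ℕ→ℚ (n ^ 10) ≤ 1ℚ
lemma2 = (λ n τ _ → toAlg (Algorithm.algorithm n τ)) , Counting.C , λ n G τ ε 0<ε ε<1 →
  subst (λ p → (1ℚ - p) * ℕ→ℚ (n ^ 10) ≤ 1ℚ) (sym (success-probability≡1 n τ G 0<ε ε<1))
    (no-failure (ℕ→ℚ (n ^ 10)))
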